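{- Let $r\ge 2$ and let $G$ be a finite $(r+1)$-partite $r$-graph in which every partite $(r-1)$-tuple of vertices has strictly balanced degree. If $\rho(i)>1-\frac{1}{r}$ for all $i\in\{1,\ldots,r+1\}$, then $G$ contains a copy of $K_{r+1}^r$.
   Context: An $r$-graph is an $r$-uniform hypergraph (unweighted). It is $(r+1)$-partite with classes $V_1,\ldots,V_{r+1}$ if every edge has at most one vertex in each class. $P_i$ is the $r$-partite $r$-graph induced by the classes $V_j$, $j\ne i$, and $\rho(i)=|E(P_i)|/\prod_{j\ne i}|V_j|$. A set of vertices is partite if it has at most one vertex in each class. For a partite $(r-1)$-tuple $g$ and a class $V_i$ not meeting $g$, $d(V_i,g)$ is the number of $v\in V_i$ with $g\cup\{v\}\in E(G)$; $g$ has strictly balanced degree if $d(V_i,g)=d(V_j,g)$ for the two classes $V_i,V_j$ not meeting $g$. $K_{r+1}^r$ is the complete $r$-graph on $r+1$ vertices. -}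

module Defs where

open import Data.Nat using (ℕ; zero; suc; _∸_; _*_; _<_)
open import Data.Bool using (Bool; true; false; not; _∧_; _∨_)
open import Data.Fin using (Fin; _≟_)
open import Data.Fin.Subset using (Subset; _∈_; _⊆_; ∣_∣; _∪_; ⁅_⁆)
open import Data.Vec using ([]; _∷_; lookup)
open import Data.List using (List; []; _∷_; map; _++_; filterᵇ; length; allFin)
open import Data.Bool.ListAction using (all)
open import Data.Nat.ListAction using (product)
open import Data.Product using (Σ; _×_)
open import Relation.Binary.PropositionalEquality using (_≡_; _≢_)
open import Relation.Nullary.Decidable using (⌊_⌋)

allSubsets : (n : ℕ) → List (Subset n)
allSubsets zero    = [] ∷ []
allSubsets (suc n) = map (false ∷_) (allSubsets n) ++ map (true ∷_) (allSubsets n)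

-- Vertex set Fin N; `class v` is the
-- index i of the class V_i containing v (classes indexed by Fin (suc r),
-- i.e. V_1,...,V_{r+1}); `edge s ≡ true` means s ∈ E(G).
record PartiteGraph (r : ℕ) : Set where
  field
    N       : ℕ
    class   : Fin N → Fin (suc r)
    edge    : Subset N → Bool
    uniform : ∀ s → edge s ≡ true → ∣ s ∣ ≡ r
    partite : ∀ s → edge s ≡ true →
              ∀ u v → u ∈ s → v ∈ s → class u ≡ class v → u ≡ v

module _ {r : ℕ} (G : PartiteGraph r) where
  open PartiteGraph G

  IsPartite : Subset N → Set
  IsPartite s = ∀ u v → u ∈ s → v ∈ s → class u ≡ class v → u ≡ v

  Avoids : Fin (suc r) → Subset N → Set
  Avoids i s = ∀ v → v ∈ s → class v ≢ i

  avoidsᵇ : Fin (suc r) → Subset N → Bool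
  avoidsᵇ i s = all (λ v → not (lookup s v) ∨ not ⌊ class v ≟ i ⌋) (allFin N)

  classSize : Fin (suc r) → ℕ
  classSize i = length (filterᵇ (λ v → ⌊ class v ≟ i ⌋) (allFin N))

  -- |E(P_i)|: edges of G contained in the classes V_j, j ≠ i
  edgesP : Fin (suc r) → ℕ
  edgesP i = length (filterᵇ (λ s → edge s ∧ avoidsᵇ i s) (allSubsets N))

  prodOthers : Fin (suc r) → ℕ
  prodOthers i = product (map classSize (filterᵇ (λ j → not ⌊ j ≟ i ⌋) (allFin (suc r))))

  -- ρ(i) > 1 - 1/r, i.e. |E(P_i)| / ∏_{j≠i}|V_j| > (r-1)/r, cleared of
  -- denominators:  (r-1) · ∏_{j≠i}|V_j| < r · |E(P_i)|
  DensityAbove : Fin (suc r) → Set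
  DensityAbove i = (r ∸ 1) * prodOthers i < r * edgesP i

  deg : Fin (suc r) → Subset N → ℕ
  deg i g = length (filterᵇ (λ v → ⌊ class v ≟ i ⌋ ∧ edge (g ∪ ⁅ v ⁆)) (allFin N))

  -- every partite (r-1)-tuple g has strictly balanced degree:
  -- d(V_i,g) = d(V_j,g) for the two classes V_i, V_j not meeting g
  AllStrictlyBalanced : Set
  AllStrictlyBalanced =
    ∀ g → IsPartite g → ∣ g ∣ ≡ r ∸ 1 →
    ∀ i j → i ≢ j → Avoids i g → Avoids j g → deg i g ≡ deg j g

  ContainsK : Set
  ContainsK = Σ (Subset N) (λ S → ∣ S ∣ ≡ suc r × (∀ T → T ⊆ S → ∣ T ∣ ≡ r → edge T ≡ true))

module Submission where

-- Write r = q + 2 and let the M = r + 1 classes be indexed by Fin M.  A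
-- transversal t picks one vertex t(c) ∈ V_c per class; there are
-- Π = ∏_c |V_c| of them.  Let e_k(t) ∈ {0,1} say that t minus its k-th vertex
-- is an edge, E_k = Σ_t e_k(t) and X = Σ_k E_k.
--   (1) Density: |V_k|·|E(P_k)| ≤ E_k, hence (r-1)·Π < r·E_k for all k.
--   (2) Pair inequality: for i ≠ j, E_i·E_j ≤ Π·P_ij with P_ij = Σ_t e_i e_j.
--       Fixing the other r-1 vertices σ, e_i only depends on t(j) and e_j only
--       on t(i); balance makes both degrees equal to one number D(σ), and
--       Cauchy–Schwarz on Σ_σ D(σ) concludes.
--   (3) If no transversal has all e_k = 1, then Σ_{i≠j} e_i e_j ≤ (r-1)·Σ_k e_k
--       pointwise, so Σ_{i≠j} P_ij ≤ (r-1)·X.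
--   (4) Summing (r-1)Π(E_i+E_j) < 2r·E_i E_j (from (1)) over i ≠ j and using
--       (2), (3) gives 2r(r-1)Π·X < 2r(r-1)Π·X, a contradiction.
-- Hence some transversal has all e_k = 1: its r+1 vertices span a K_{r+1}^r.

open import Defs
open import Data.Nat using (ℕ; zero; suc; _+_; _*_; _≤_; _<_; z≤n; s≤s; >-nonZero)
open import Data.Nat.Properties hiding (_≟_; suc-injective)
open import Data.Bool using (Bool; true; false; not; _∧_; _∨_; if_then_else_)
import Data.Bool.Properties as BP
open import Data.List using (List; []; _∷_; map; _++_; filterᵇ; length; allFin; tabulate; concatMap)
open import Data.List.Properties using (map-tabulate; map-cong; map-∘)
import Data.List.Membership.Propositional as LM
open import Data.List.Membership.Propositional.Properties using (∈-allFin; ∈-map⁺; ∈-++⁺ˡ; ∈-++⁺ʳ)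
open import Data.List.Relation.Unary.Any using (here; there)
import Data.List.Relation.Unary.All as All
open import Data.List.Relation.Unary.All.Properties using (all⁺)
open import Function.Bundles using (Equivalence)
open import Data.Fin using (Fin; zero; suc; punchIn; punchOut; _≟_)
open import Data.Fin.Properties using (punchInᵢ≢i; suc-injective; punchIn-injective; punchIn-punchOut)
open import Data.Fin.Subset using (Subset; _∈_; _⊆_; ∣_∣; _∪_; ⁅_⁆)
open import Data.Fin.Subset.Properties using (p⊂q⇒∣p∣<∣q∣)
open import Data.Vec using (Vec; []; _∷_; lookup; insertAt)
import Data.Vec as V
open import Data.Vec.Properties using (insertAt-lookup; insertAt-punchIn; []=⇒lookup; lookup⇒[]=; lookup-zipWith; lookup∘tabulate; tabulate∘lookup; tabulate-cong; ≡-dec; lookup-replicate)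
open import Data.Product using (Σ; _×_; _,_; proj₁; proj₂)
open import Data.Sum using (_⊎_; inj₁; inj₂)
open import Relation.Binary.PropositionalEquality
open import Relation.Nullary.Decidable using (⌊_⌋; yes; no)
open import Relation.Nullary using (¬_)
open import Data.Empty using (⊥-elim)
open import Data.Nat.ListAction using (product)
open import Data.Bool.ListAction using (all)
open import Data.Nat.Tactic.RingSolver using (solve-∀)

𝟙 : Bool → ℕ
𝟙 true  = 1
𝟙 false = 0

𝟙≤1 : ∀ b → 𝟙 b ≤ 1
𝟙≤1 true  = s≤s z≤n
𝟙≤1 false = z≤n

𝟙-∧ : ∀ a b → 𝟙 (a ∧ b) ≡ 𝟙 a * 𝟙 b
𝟙-∧ true  b = sym (+-identityʳ (𝟙 b))
𝟙-∧ false b = refl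

𝟙-pos : ∀ {b} → 0 < 𝟙 b → b ≡ true
𝟙-pos {true} _ = refl

𝟙-zero : ∀ {b} → 𝟙 b ≡ 0 → b ≡ false
𝟙-zero {false} _ = refl

true≢false : ¬ true ≡ false
true≢false ()

not-true : ∀ {b} → not b ≡ true → b ≡ false
not-true {false} _ = refl

∧-split : ∀ {a b} → (a ∧ b) ≡ true → a ≡ true × b ≡ true
∧-split {true} {true} _ = refl , refl

pos-* : ∀ a b → 0 < a * b → 0 < a × 0 < b
pos-* (suc a) zero    p rewrite *-zeroʳ a = ⊥-elim (<-irrefl refl p)
pos-* (suc a) (suc b) p = s≤s z≤n , s≤s z≤n

module _ {a} {A : Set a} where
  sumL : List A → (A → ℕ) → ℕ
  sumL []       f = 0
  sumL (x ∷ xs) f = f x + sumL xs f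

  sumL-cong : ∀ xs {f g : A → ℕ} → (∀ x → f x ≡ g x) → sumL xs f ≡ sumL xs g
  sumL-cong []       e = refl
  sumL-cong (x ∷ xs) e = cong₂ _+_ (e x) (sumL-cong xs e)

  sumL-mono : ∀ xs {f g : A → ℕ} → (∀ x → f x ≤ g x) → sumL xs f ≤ sumL xs g
  sumL-mono []       e = z≤n
  sumL-mono (x ∷ xs) e = +-mono-≤ (e x) (sumL-mono xs e)

  sumL-strict : ∀ xs {f g : A → ℕ} {x} → (∀ x → f x ≤ g x) → x LM.∈ xs → f x < g x →
                sumL xs f < sumL xs g
  sumL-strict (y ∷ xs) le (here refl) lt = +-mono-<-≤ lt (sumL-mono xs le)
  sumL-strict (y ∷ xs) le (there p)   lt = +-mono-≤-< (le y) (sumL-strict xs le p lt)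

  sumL-0 : ∀ xs {f : A → ℕ} → (∀ x → f x ≡ 0) → sumL xs f ≡ 0
  sumL-0 []       e = refl
  sumL-0 (x ∷ xs) e = cong₂ _+_ (e x) (sumL-0 xs e)

  sumL-+ : ∀ xs (f g : A → ℕ) → sumL xs (λ x → f x + g x) ≡ sumL xs f + sumL xs g
  sumL-+ []       f g = refl
  sumL-+ (x ∷ xs) f g rewrite sumL-+ xs f g = +-+-swap (f x) (g x) (sumL xs f) (sumL xs g)
    where
    +-+-swap : ∀ a b c d → a + b + (c + d) ≡ a + c + (b + d)
    +-+-swap = solve-∀

  sumL-*ˡ : ∀ xs c (f : A → ℕ) → sumL xs (λ x → c * f x) ≡ c * sumL xs f
  sumL-*ˡ []       c f = sym (*-zeroʳ c)
  sumL-*ˡ (x ∷ xs) c f rewrite sumL-*ˡ xs c f = sym (*-distribˡ-+ c (f x) (sumL xs f))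

  sumL-*ʳ : ∀ xs c (f : A → ℕ) → sumL xs (λ x → f x * c) ≡ sumL xs f * c
  sumL-*ʳ xs c f = trans (sumL-cong xs (λ x → *-comm (f x) c))
                         (trans (sumL-*ˡ xs c f) (*-comm c (sumL xs f)))

  sumL-++ : ∀ xs ys (f : A → ℕ) → sumL (xs ++ ys) f ≡ sumL xs f + sumL ys f
  sumL-++ []       ys f = refl
  sumL-++ (x ∷ xs) ys f rewrite sumL-++ xs ys f = sym (+-assoc (f x) _ _)

  sumL-term : ∀ {xs} {x} (f : A → ℕ) → x LM.∈ xs → f x ≤ sumL xs f
  sumL-term {x ∷ xs} f (here refl) = m≤m+n (f x) _
  sumL-term {y ∷ xs} f (there p)   = ≤-trans (sumL-term f p) (m≤n+m _ (f y))

  sumL-pos : ∀ xs (f : A → ℕ) → 0 < sumL xs f → Σ A (λ x → 0 < f x)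
  sumL-pos (x ∷ xs) f p with f x in eq
  ... | suc k = x , subst (0 <_) (sym eq) (s≤s z≤n)
  ... | zero  = sumL-pos xs f p

  length-filterᵇ : ∀ xs (p : A → Bool) → length (filterᵇ p xs) ≡ sumL xs (λ x → 𝟙 (p x))
  length-filterᵇ []       p = refl
  length-filterᵇ (x ∷ xs) p with p x
  ... | true  = cong suc (length-filterᵇ xs p)
  ... | false = length-filterᵇ xs p

module _ {a b} {A : Set a} {B : Set b} where
  sumL-map : ∀ (g : A → B) xs (f : B → ℕ) → sumL (map g xs) f ≡ sumL xs (λ x → f (g x))
  sumL-map g []       f = refl
  sumL-map g (x ∷ xs) f = cong (f (g x) +_) (sumL-map g xs f)

  sumL-swap : ∀ xs ys (f : A → B → ℕ) →
    sumL xs (λ x → sumL ys (λ y → f x y)) ≡ sumL ys (λ y → sumL xs (λ x → f x y))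
  sumL-swap []       ys f = sym (sumL-0 ys (λ _ → refl))
  sumL-swap (x ∷ xs) ys f rewrite sumL-swap xs ys f =
    sym (sumL-+ ys (f x) (λ y → sumL xs (λ x → f x y)))

  sumL-concatMap : ∀ (g : A → List B) xs (f : B → ℕ) →
    sumL (concatMap g xs) f ≡ sumL xs (λ x → sumL (g x) f)
  sumL-concatMap g []       f = refl
  sumL-concatMap g (x ∷ xs) f rewrite sumL-++ (g x) (concatMap g xs) f =
    cong (sumL (g x) f +_) (sumL-concatMap g xs f)

all-true : ∀ {a} {A : Set a} (p : A → Bool) xs → all p xs ≡ true → ∀ {x} → x LM.∈ xs → p x ≡ true
all-true p xs h x∈xs = Equivalence.to BP.T-≡ (All.lookup (all⁺ p xs (Equivalence.from BP.T-≡ h)) x∈xs)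

sumL-factor : ∀ {a} {A : Set a} (xs : List A) (w : ℕ) (f g : A → ℕ) →
  sumL xs (λ x → sumL xs (λ y → w * (f x * g y))) ≡ w * (sumL xs f * sumL xs g)
sumL-factor xs w f g = begin
    sumL xs (λ x → sumL xs (λ y → w * (f x * g y)))
  ≡⟨ sumL-cong xs (λ x → trans (sumL-cong xs (λ y → sym (*-assoc w (f x) (g y))))
                               (sumL-*ˡ xs (w * f x) g)) ⟩
    sumL xs (λ x → w * f x * sumL xs g)
  ≡⟨ sumL-*ʳ xs (sumL xs g) (λ x → w * f x) ⟩
    sumL xs (λ x → w * f x) * sumL xs g
  ≡⟨ cong (_* sumL xs g) (sumL-*ˡ xs w f) ⟩
    w * sumL xs f * sumL xs g
  ≡⟨ *-assoc w (sumL xs f) (sumL xs g) ⟩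
    w * (sumL xs f * sumL xs g)
  ∎
  where open ≡-Reasoning

-- Weighted Cauchy–Schwarz:  (Σ w·d)² ≤ (Σ w)·(Σ w·d²).  Proved from
-- 2ab ≤ a² + b² by induction on the list.
two-ab≤a²+b²-ordered : ∀ {a b} → a ≤ b → 2 * (a * b) ≤ a * a + b * b
two-ab≤a²+b²-ordered {a} {b} a≤b with m≤n⇒∃[o]m+o≡n a≤b
... | k , refl = subst (2 * (a * (a + k)) ≤_) (sym (expand a k)) (m≤m+n _ (k * k))
  where
  expand : ∀ a k → a * a + (a + k) * (a + k) ≡ 2 * (a * (a + k)) + k * k
  expand = solve-∀

two-ab≤a²+b² : ∀ a b → 2 * (a * b) ≤ a * a + b * b
two-ab≤a²+b² a b with ≤-total a b
... | inj₁ a≤b = two-ab≤a²+b²-ordered a≤b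
... | inj₂ b≤a = subst₂ _≤_ (cong (2 *_) (*-comm b a)) (+-comm (b * b) (a * a))
                           (two-ab≤a²+b²-ordered b≤a)

module _ {a} {A : Set a} where
  -- 2c·Σ w d ≤ Σ w d² + c²·Σ w, i.e. Σ w (d - c)² ≥ 0 expanded
  cauchy-schwarz-aux : ∀ xs (w d : A → ℕ) (c : ℕ) →
    2 * (c * sumL xs (λ x → w x * d x)) ≤ sumL xs (λ x → w x * (d x * d x)) + c * c * sumL xs w
  cauchy-schwarz-aux []       w d c rewrite *-zeroʳ c | *-zeroʳ (c * c) = z≤n
  cauchy-schwarz-aux (x ∷ xs) w d c =
    subst₂ _≤_ (sym (lhs (w x) (d x) c (sumL xs (λ x → w x * d x))))
               (sym (rhs (w x) (d x) c (sumL xs (λ x → w x * (d x * d x))) (sumL xs w)))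
               (+-mono-≤ (*-monoʳ-≤ (w x) (two-ab≤a²+b² c (d x))) (cauchy-schwarz-aux xs w d c))
    where
    lhs : ∀ a b c s → 2 * (c * (a * b + s)) ≡ a * (2 * (c * b)) + 2 * (c * s)
    lhs = solve-∀
    rhs : ∀ a b c s t → a * (b * b) + s + c * c * (a + t) ≡ a * (c * c + b * b) + (s + c * c * t)
    rhs = solve-∀

  cauchy-schwarz : ∀ xs (w d : A → ℕ) →
    sumL xs (λ x → w x * d x) * sumL xs (λ x → w x * d x) ≤
    sumL xs w * sumL xs (λ x → w x * (d x * d x))
  cauchy-schwarz []       w d = z≤n
  cauchy-schwarz (x ∷ xs) w d =
    subst₂ _≤_ (sym (lhs (w x) (d x) S)) (sym (rhs (w x) (d x) W Q))
      (+-mono-≤ (≤-refl {w x * d x * (w x * d x)})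
                (+-mono-≤ (*-monoʳ-≤ (w x) (cauchy-schwarz-aux xs w d (d x))) (cauchy-schwarz xs w d)))
    where
    S W Q : ℕ
    S = sumL xs (λ x → w x * d x)
    W = sumL xs w
    Q = sumL xs (λ x → w x * (d x * d x))
    lhs : ∀ a b S → (a * b + S) * (a * b + S) ≡ a * b * (a * b) + (a * (2 * (b * S)) + S * S)
    lhs = solve-∀
    rhs : ∀ a b W Q → (a + W) * (a * (b * b) + Q) ≡ a * b * (a * b) + (a * (Q + b * b * W) + W * Q)
    rhs = solve-∀

-- The arithmetic behind step (4): if p < R·a and p < R·b then
-- p·(a + b) < 2R·ab  (write R·a = 1 + p + s, R·b = 1 + p + t and expand).
pair-arith : ∀ p R a b → p < R * a → p < R * b → p * (a + b) < 2 * R * (a * b)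
pair-arith p R a b p<Ra p<Rb = *-cancelˡ-< R _ _ (subst₂ _<_ (scaleˡ p R a b) (scaleʳ R a b) core)
  where
  scaleˡ : ∀ p R a b → p * (R * a + R * b) ≡ R * (p * (a + b))
  scaleˡ = solve-∀
  scaleʳ : ∀ R a b → 2 * ((R * a) * (R * b)) ≡ R * (2 * R * (a * b))
  scaleʳ = solve-∀
  core : p * (R * a + R * b) < 2 * ((R * a) * (R * b))
  core with m≤n⇒∃[o]m+o≡n p<Ra | m≤n⇒∃[o]m+o≡n p<Rb
  ... | s , Ra≡ | t , Rb≡ rewrite sym Ra≡ | sym Rb≡ =
    subst (p * (suc (p + s) + suc (p + t)) <_) (sym (expand p s t)) (s≤s (m≤m+n _ _))
    where
    expand : ∀ p s t → 2 * (suc (p + s) * suc (p + t)) ≡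
      suc (p * (suc (p + s) + suc (p + t)) + (p * s + p * t + 2 * p + 2 * s * t + 2 * s + 2 * t + 1))
    expand = solve-∀

ΣF : ∀ m → (Fin m → ℕ) → ℕ
ΣF m f = sumL (allFin m) f

ΠF : ∀ m → (Fin m → ℕ) → ℕ
ΠF m f = product (map f (allFin m))

ΣF-cong : ∀ m {f g : Fin m → ℕ} → (∀ x → f x ≡ g x) → ΣF m f ≡ ΣF m g
ΣF-cong m = sumL-cong (allFin m)

ΠF-cong : ∀ m {f g : Fin m → ℕ} → (∀ x → f x ≡ g x) → ΠF m f ≡ ΠF m g
ΠF-cong m e = cong product (map-cong e (allFin m))

allFin-suc : ∀ m → allFin (suc m) ≡ zero ∷ map suc (allFin m)
allFin-suc m = cong (zero ∷_) (sym (map-tabulate (λ i → i) suc))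

ΣF-suc : ∀ m f → ΣF (suc m) f ≡ f zero + ΣF m (λ i → f (suc i))
ΣF-suc m f = trans (cong (λ xs → sumL xs f) (allFin-suc m))
                   (cong (f zero +_) (sumL-map suc (allFin m) f))

ΠF-suc : ∀ m f → ΠF (suc m) f ≡ f zero * ΠF m (λ i → f (suc i))
ΠF-suc m f = trans (cong (λ xs → product (map f xs)) (allFin-suc m))
                   (cong (λ xs → f zero * product xs) (sym (map-∘ (allFin m))))

ΣF-punchIn : ∀ m (i : Fin (suc m)) f → ΣF (suc m) f ≡ f i + ΣF m (λ c → f (punchIn i c))
ΣF-punchIn m       zero    f = ΣF-suc m f
ΣF-punchIn (suc m) (suc i) f = begin
    ΣF (suc (suc m)) f
  ≡⟨ ΣF-suc (suc m) f ⟩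
    f zero + ΣF (suc m) (λ c → f (suc c))
  ≡⟨ cong (f zero +_) (ΣF-punchIn m i (λ c → f (suc c))) ⟩
    f zero + (f (suc i) + ΣF m (λ c → f (suc (punchIn i c))))
  ≡⟨ +-exchange (f zero) (f (suc i)) _ ⟩
    f (suc i) + (f zero + ΣF m (λ c → f (suc (punchIn i c))))
  ≡⟨ cong (f (suc i) +_) (sym (ΣF-suc m (λ c → f (punchIn (suc i) c)))) ⟩
    f (suc i) + ΣF (suc m) (λ c → f (punchIn (suc i) c))
  ∎
  where
  open ≡-Reasoning
  +-exchange : ∀ a b c → a + (b + c) ≡ b + (a + c)
  +-exchange = solve-∀

ΠF-punchIn : ∀ m (i : Fin (suc m)) f → ΠF (suc m) f ≡ f i * ΠF m (λ c → f (punchIn i c))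
ΠF-punchIn m       zero    f = ΠF-suc m f
ΠF-punchIn (suc m) (suc i) f = begin
    ΠF (suc (suc m)) f
  ≡⟨ ΠF-suc (suc m) f ⟩
    f zero * ΠF (suc m) (λ c → f (suc c))
  ≡⟨ cong (f zero *_) (ΠF-punchIn m i (λ c → f (suc c))) ⟩
    f zero * (f (suc i) * ΠF m (λ c → f (suc (punchIn i c))))
  ≡⟨ *-exchange (f zero) (f (suc i)) _ ⟩
    f (suc i) * (f zero * ΠF m (λ c → f (suc (punchIn i c))))
  ≡⟨ cong (f (suc i) *_) (sym (ΠF-suc m (λ c → f (punchIn (suc i) c)))) ⟩
    f (suc i) * ΠF (suc m) (λ c → f (punchIn (suc i) c))
  ∎
  where
  open ≡-Reasoning
  *-exchange : ∀ a b c → a * (b * c) ≡ b * (a * c)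
  *-exchange = solve-∀

ΣF-const : ∀ m c → ΣF m (λ _ → c) ≡ m * c
ΣF-const zero    c = refl
ΣF-const (suc m) c = trans (ΣF-suc m (λ _ → c)) (cong (c +_) (ΣF-const m c))

ΣF-1 : ∀ m → ΣF m (λ _ → 1) ≡ m
ΣF-1 m = trans (ΣF-const m 1) (*-identityʳ m)

ΠF-1 : ∀ m (f : Fin m → ℕ) → (∀ c → f c ≡ 1) → ΠF m f ≡ 1
ΠF-1 zero    f e = refl
ΠF-1 (suc m) f e = trans (ΠF-suc m f) (cong₂ _*_ (e zero) (ΠF-1 m _ (λ c → e (suc c))))

ΠF-bits : ∀ m (f : Fin m → ℕ) → (∀ c → f c ≤ 1) →
  (ΠF m f ≡ 0 × Σ (Fin m) (λ c → f c ≡ 0)) ⊎ (ΠF m f ≡ 1 × (∀ c → f c ≡ 1))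
ΠF-bits zero    f h = inj₂ (refl , λ ())
ΠF-bits (suc m) f h = combine (f zero) refl (h zero) (ΠF-bits m (λ i → f (suc i)) (λ c → h (suc c)))
  where
  P : ℕ
  P = ΠF m (λ i → f (suc i))
  combine : ∀ a → f zero ≡ a → a ≤ 1 →
    (P ≡ 0 × Σ (Fin m) (λ c → f (suc c) ≡ 0)) ⊎ (P ≡ 1 × (∀ c → f (suc c) ≡ 1)) →
    (ΠF (suc m) f ≡ 0 × Σ (Fin (suc m)) (λ c → f c ≡ 0)) ⊎ (ΠF (suc m) f ≡ 1 × (∀ c → f c ≡ 1))
  combine zero          f0 _ _                   = inj₁ (trans (ΠF-suc m f) (cong (_* P) f0) , zero , f0)
  combine (suc zero)    f0 _ (inj₁ (p , c , q)) = inj₁ (trans (ΠF-suc m f) (cong₂ _*_ f0 p) , suc c , q)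
  combine (suc zero)    f0 _ (inj₂ (p , q))     =
    inj₂ (trans (ΠF-suc m f) (cong₂ _*_ f0 p) , λ { zero → f0 ; (suc c) → q c })
  combine (suc (suc _)) _ (s≤s ()) _

ΣF-at-most-one : ∀ n (f : Fin n → ℕ) → (∀ v → f v ≤ 1) → (∀ u v → 0 < f u → 0 < f v → u ≡ v) → ΣF n f ≤ 1
ΣF-at-most-one zero    f bit unique = z≤n
ΣF-at-most-one (suc n) f bit unique = subst (_≤ 1) (sym (ΣF-suc n f)) (by-head (f zero) refl (bit zero))
  where
  by-head : ∀ a → f zero ≡ a → a ≤ 1 → a + ΣF n (λ i → f (suc i)) ≤ 1
  by-head zero f0 _ = ΣF-at-most-one n (λ i → f (suc i)) (λ v → bit (suc v))
                        (λ u v p q → suc-injective (unique (suc u) (suc v) p q))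
  by-head (suc zero) f0 _ = subst (λ z → 1 + z ≤ 1) (sym (sumL-0 (allFin n) rest-zero)) ≤-refl
    where
    rest-zero : ∀ v → f (suc v) ≡ 0
    rest-zero v with f (suc v) in fv
    ... | zero  = refl
    ... | suc _ with unique zero (suc v) (subst (0 <_) (sym f0) (s≤s z≤n)) (subst (0 <_) (sym fv) (s≤s z≤n))
    ...   | ()
  by-head (suc (suc a)) f0 (s≤s ())

product-filter : ∀ {a} {A : Set a} (f : A → ℕ) (p : A → Bool) xs →
  product (map f (filterᵇ p xs)) ≡ product (map (λ x → if p x then f x else 1) xs)
product-filter f p []       = refl
product-filter f p (x ∷ xs) with p x
... | true  = cong (f x *_) (product-filter f p xs)
... | false = trans (product-filter f p xs) (sym (+-identityʳ _))

-- Structural boolean equality on Fin; it reduces by pattern matching, which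
-- makes Kronecker-delta computations definitional.
infix 7 _≡ᵇ_ _≢ᵇ_
_≡ᵇ_ : ∀ {n} → Fin n → Fin n → Bool
zero  ≡ᵇ zero  = true
zero  ≡ᵇ suc b = false
suc a ≡ᵇ zero  = false
suc a ≡ᵇ suc b = a ≡ᵇ b

_≢ᵇ_ : ∀ {n} → Fin n → Fin n → Bool
a ≢ᵇ b = not (a ≡ᵇ b)

≡ᵇ-refl : ∀ {n} (a : Fin n) → (a ≡ᵇ a) ≡ true
≡ᵇ-refl zero    = refl
≡ᵇ-refl (suc a) = ≡ᵇ-refl a

≡ᵇ-sound : ∀ {n} {a b : Fin n} → (a ≡ᵇ b) ≡ true → a ≡ b
≡ᵇ-sound {a = zero}  {zero}  e = refl
≡ᵇ-sound {a = suc a} {suc b} e = cong suc (≡ᵇ-sound e)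

≡ᵇ-≢ : ∀ {n} {a b : Fin n} → ¬ a ≡ b → (a ≡ᵇ b) ≡ false
≡ᵇ-≢ {a = a} {b} a≢b with a ≡ᵇ b in e
... | true  = ⊥-elim (a≢b (≡ᵇ-sound e))
... | false = refl

≡ᵇ-sym : ∀ {n} (a b : Fin n) → (a ≡ᵇ b) ≡ (b ≡ᵇ a)
≡ᵇ-sym zero    zero    = refl
≡ᵇ-sym zero    (suc b) = refl
≡ᵇ-sym (suc a) zero    = refl
≡ᵇ-sym (suc a) (suc b) = ≡ᵇ-sym a b

⌊≟⌋≡≡ᵇ : ∀ {n} (a b : Fin n) → ⌊ a ≟ b ⌋ ≡ (a ≡ᵇ b)
⌊≟⌋≡≡ᵇ a b with a ≟ b
... | yes refl = sym (≡ᵇ-refl a)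
... | no a≢b   = sym (≡ᵇ-≢ a≢b)

δ : ∀ {n} → Fin n → Fin n → ℕ
δ a b = 𝟙 (a ≡ᵇ b)

δ-refl : ∀ {n} (a : Fin n) → δ a a ≡ 1
δ-refl a = cong 𝟙 (≡ᵇ-refl a)

δ-≢ : ∀ {n} {a b : Fin n} → ¬ a ≡ b → δ a b ≡ 0
δ-≢ a≢b = cong 𝟙 (≡ᵇ-≢ a≢b)

δ≤1 : ∀ {n} (a b : Fin n) → δ a b ≤ 1
δ≤1 a b = 𝟙≤1 _

δ-pos : ∀ {n} {a b : Fin n} → 0 < δ a b → a ≡ b
δ-pos {a = a} {b} p with a ≡ᵇ b in e
... | true = ≡ᵇ-sound e

sum-delta : ∀ {m} (a : Fin m) (g : Fin m → ℕ) → ΣF m (λ v → δ a v * g v) ≡ g a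
sum-delta {suc m} a g = begin
    ΣF (suc m) (λ v → δ a v * g v)
  ≡⟨ ΣF-punchIn m a (λ v → δ a v * g v) ⟩
    δ a a * g a + ΣF m (λ c → δ a (punchIn a c) * g (punchIn a c))
  ≡⟨ cong₂ _+_ (cong (_* g a) (δ-refl a))
               (sumL-0 (allFin m) (λ c → cong (_* g (punchIn a c)) (δ-≢ (λ e → punchInᵢ≢i a c (sym e))))) ⟩
    1 * g a + 0
  ≡⟨ trans (+-identityʳ _) (*-identityˡ (g a)) ⟩
    g a
  ∎
  where open ≡-Reasoning

sum-delta′ : ∀ {m} (a : Fin m) (g : Fin m → ℕ) → ΣF m (λ v → δ v a * g v) ≡ g a
sum-delta′ {m} a g = trans (ΣF-cong m (λ v → cong (λ b → 𝟙 b * g v) (≡ᵇ-sym v a))) (sum-delta a g)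

ΣF-δ : ∀ {m} (a : Fin m) → ΣF m (λ v → δ v a) ≡ 1
ΣF-δ {m} a = trans (ΣF-cong m (λ v → sym (*-identityʳ (δ v a)))) (sum-delta′ a (λ _ → 1))

δ+≢ᵇ : ∀ {n} (i j : Fin n) → δ i j + 𝟙 (i ≢ᵇ j) ≡ 1
δ+≢ᵇ i j with i ≡ᵇ j
... | true  = refl
... | false = refl

count-≢ᵇ : ∀ m (k : Fin (suc m)) → ΣF (suc m) (λ c → 𝟙 (c ≢ᵇ k)) ≡ m
count-≢ᵇ m k = begin
    ΣF (suc m) (λ c → 𝟙 (c ≢ᵇ k))
  ≡⟨ ΣF-punchIn m k (λ c → 𝟙 (c ≢ᵇ k)) ⟩
    𝟙 (not (k ≡ᵇ k)) + ΣF m (λ c → 𝟙 (not (punchIn k c ≡ᵇ k)))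
  ≡⟨ cong₂ _+_ (cong (λ b → 𝟙 (not b)) (≡ᵇ-refl k))
               (ΣF-cong m (λ c → cong (λ b → 𝟙 (not b)) (≡ᵇ-≢ (punchInᵢ≢i k c)))) ⟩
    ΣF m (λ _ → 1)
  ≡⟨ ΣF-1 m ⟩
    m
  ∎
  where open ≡-Reasoning

count-≢ᵇ₂ : ∀ m (i : Fin (suc (suc m))) (j′ : Fin (suc m)) →
  ΣF (suc (suc m)) (λ c → 𝟙 (c ≢ᵇ i ∧ c ≢ᵇ punchIn i j′)) ≡ m
count-≢ᵇ₂ m i j′ = begin
    ΣF (suc (suc m)) (λ c → 𝟙 (c ≢ᵇ i ∧ c ≢ᵇ j))
  ≡⟨ ΣF-punchIn (suc m) i (λ c → 𝟙 (c ≢ᵇ i ∧ c ≢ᵇ j)) ⟩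
    𝟙 (not (i ≡ᵇ i) ∧ i ≢ᵇ j) + ΣF (suc m) (λ c → 𝟙 (i′ c ≢ᵇ i ∧ i′ c ≢ᵇ j))
  ≡⟨ cong₂ _+_ (cong (λ b → 𝟙 (not b ∧ i ≢ᵇ j)) (≡ᵇ-refl i))
               (ΣF-punchIn m j′ (λ c → 𝟙 (i′ c ≢ᵇ i ∧ i′ c ≢ᵇ j))) ⟩
    0 + (𝟙 (j ≢ᵇ i ∧ not (j ≡ᵇ j)) + ΣF m (λ c → 𝟙 (i′ (j″ c) ≢ᵇ i ∧ i′ (j″ c) ≢ᵇ j)))
  ≡⟨ cong₂ _+_ (cong (λ b → 𝟙 (j ≢ᵇ i ∧ not b)) (≡ᵇ-refl j))
       (ΣF-cong m (λ c → cong₂ (λ a b → 𝟙 (not a ∧ not b))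
          (≡ᵇ-≢ (punchInᵢ≢i i (j″ c)))
          (≡ᵇ-≢ (λ e → punchInᵢ≢i j′ c (punchIn-injective i _ _ e))))) ⟩
    𝟙 (j ≢ᵇ i ∧ false) + ΣF m (λ _ → 1)
  ≡⟨ cong₂ _+_ (cong 𝟙 (BP.∧-zeroʳ (j ≢ᵇ i))) (ΣF-1 m) ⟩
    m
  ∎
  where
  open ≡-Reasoning
  j : Fin (suc (suc m))
  j = punchIn i j′
  i′ : Fin (suc m) → Fin (suc (suc m))
  i′ = punchIn i
  j″ : Fin m → Fin (suc m)
  j″ = punchIn j′

Σ≠ : ∀ n → (Fin n → Fin n → ℕ) → ℕ
Σ≠ n f = ΣF n (λ i → ΣF n (λ j → 𝟙 (i ≢ᵇ j) * f i j))

≡ᵇ-false : ∀ {n} {i j : Fin n} → (i ≡ᵇ j) ≡ false → ¬ i ≡ j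
≡ᵇ-false {i = i} i≢ᵇj refl = true≢false (trans (sym (≡ᵇ-refl i)) i≢ᵇj)

Σ≠-term-mono : ∀ {n} {f g : Fin n → Fin n → ℕ} → (∀ i j → ¬ i ≡ j → f i j ≤ g i j) →
               ∀ i j → 𝟙 (i ≢ᵇ j) * f i j ≤ 𝟙 (i ≢ᵇ j) * g i j
Σ≠-term-mono le i j with i ≡ᵇ j in i≡ᵇj
... | true  = z≤n
... | false = +-monoˡ-≤ 0 (le i j (≡ᵇ-false i≡ᵇj))

Σ≠-mono : ∀ n {f g : Fin n → Fin n → ℕ} → (∀ i j → ¬ i ≡ j → f i j ≤ g i j) → Σ≠ n f ≤ Σ≠ n g
Σ≠-mono n le = sumL-mono (allFin n) (λ i → sumL-mono (allFin n) (Σ≠-term-mono le i))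

Σ≠-strict : ∀ n {f g : Fin n → Fin n → ℕ} → (∀ i j → ¬ i ≡ j → f i j ≤ g i j) →
            ∀ a b → ¬ a ≡ b → f a b < g a b → Σ≠ n f < Σ≠ n g
Σ≠-strict n le a b a≢b lt =
  sumL-strict (allFin n) (λ i → sumL-mono (allFin n) (Σ≠-term-mono le i)) (∈-allFin a)
    (sumL-strict (allFin n) (Σ≠-term-mono le a) (∈-allFin b) strict-at)
  where
  strict-at : 𝟙 (a ≢ᵇ b) * _ < 𝟙 (a ≢ᵇ b) * _
  strict-at rewrite ≡ᵇ-≢ a≢b = +-monoˡ-< 0 lt

Σ≠-*ˡ : ∀ n c (f : Fin n → Fin n → ℕ) → Σ≠ n (λ i j → c * f i j) ≡ c * Σ≠ n f
Σ≠-*ˡ n c f =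
  trans (ΣF-cong n (λ i → trans (ΣF-cong n (λ j → *-exchange (𝟙 (i ≢ᵇ j)) c (f i j)))
                                (sumL-*ˡ (allFin n) c (λ j → 𝟙 (i ≢ᵇ j) * f i j))))
        (sumL-*ˡ (allFin n) c (λ i → ΣF n (λ j → 𝟙 (i ≢ᵇ j) * f i j)))
  where
  *-exchange : ∀ a b c → a * (b * c) ≡ b * (a * c)
  *-exchange = solve-∀

-- each index has m partners among suc m indices, in each of the two slots
Σ≠-+ : ∀ m (a : Fin (suc m) → ℕ) → Σ≠ (suc m) (λ i j → a i + a j) ≡ m * ΣF (suc m) a + m * ΣF (suc m) a
Σ≠-+ m a = begin
    Σ≠ n (λ i j → a i + a j)
  ≡⟨ ΣF-cong n (λ i → trans (ΣF-cong n (λ j → *-distribˡ-+ (𝟙 (i ≢ᵇ j)) (a i) (a j)))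
                            (sumL-+ (allFin n) (λ j → 𝟙 (i ≢ᵇ j) * a i) (λ j → 𝟙 (i ≢ᵇ j) * a j))) ⟩
    ΣF n (λ i → ΣF n (λ j → 𝟙 (i ≢ᵇ j) * a i) + ΣF n (λ j → 𝟙 (i ≢ᵇ j) * a j))
  ≡⟨ sumL-+ (allFin n) (λ i → ΣF n (λ j → 𝟙 (i ≢ᵇ j) * a i)) (λ i → ΣF n (λ j → 𝟙 (i ≢ᵇ j) * a j)) ⟩
    ΣF n (λ i → ΣF n (λ j → 𝟙 (i ≢ᵇ j) * a i)) + ΣF n (λ i → ΣF n (λ j → 𝟙 (i ≢ᵇ j) * a j))
  ≡⟨ cong₂ _+_ (ΣF-cong n row) (sumL-swap (allFin n) (allFin n) (λ i j → 𝟙 (i ≢ᵇ j) * a j)) ⟩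
    ΣF n (λ i → m * a i) + ΣF n (λ j → ΣF n (λ i → 𝟙 (i ≢ᵇ j) * a j))
  ≡⟨ cong₂ _+_ (sumL-*ˡ (allFin n) m a) (trans (ΣF-cong n column) (sumL-*ˡ (allFin n) m a)) ⟩
    m * ΣF n a + m * ΣF n a
  ∎
  where
  open ≡-Reasoning
  n : ℕ
  n = suc m
  row : ∀ i → ΣF n (λ j → 𝟙 (i ≢ᵇ j) * a i) ≡ m * a i
  row i = trans (sumL-*ʳ (allFin n) (a i) (λ j → 𝟙 (i ≢ᵇ j)))
                (cong (_* a i) (trans (ΣF-cong n (λ j → cong (λ b → 𝟙 (not b)) (≡ᵇ-sym i j))) (count-≢ᵇ m i)))
  column : ∀ j → ΣF n (λ i → 𝟙 (i ≢ᵇ j) * a j) ≡ m * a j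
  column j = trans (sumL-*ʳ (allFin n) (a j) (λ i → 𝟙 (i ≢ᵇ j))) (cong (_* a j) (count-≢ᵇ m j))

bits-clear≤ : ∀ m (β : Fin (suc m) → Bool) (k : Fin (suc m)) → β k ≡ false →
              ΣF (suc m) (λ j → 𝟙 (β j)) ≤ m
bits-clear≤ m β k βk = ≤-pred (subst₂ _≤_ padded (ΣF-1 (suc m)) (sumL-mono (allFin (suc m)) bounded))
  where
  b : Fin (suc m) → ℕ
  b j = 𝟙 (β j)
  bounded : ∀ j → b j + δ j k ≤ 1
  bounded j with j ≟ k
  ... | yes refl rewrite βk | δ-refl j = ≤-refl
  ... | no j≢k rewrite δ-≢ j≢k = subst (_≤ 1) (sym (+-identityʳ (b j))) (𝟙≤1 (β j))
  padded : ΣF (suc m) (λ j → b j + δ j k) ≡ suc (ΣF (suc m) b)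
  padded = trans (sumL-+ (allFin (suc m)) b (λ j → δ j k))
                 (trans (cong (ΣF (suc m) b +_) (ΣF-δ k)) (+-comm (ΣF (suc m) b) 1))

Σ≢ᵇ+self : ∀ n (b : Fin n → ℕ) i → ΣF n (λ j → 𝟙 (i ≢ᵇ j) * b j) + b i ≡ ΣF n b
Σ≢ᵇ+self n b i = begin
    ΣF n (λ j → 𝟙 (i ≢ᵇ j) * b j) + b i
  ≡⟨ cong (ΣF n (λ j → 𝟙 (i ≢ᵇ j) * b j) +_) (sym (sum-delta i b)) ⟩
    ΣF n (λ j → 𝟙 (i ≢ᵇ j) * b j) + ΣF n (λ j → δ i j * b j)
  ≡⟨ sym (sumL-+ (allFin n) (λ j → 𝟙 (i ≢ᵇ j) * b j) (λ j → δ i j * b j)) ⟩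
    ΣF n (λ j → 𝟙 (i ≢ᵇ j) * b j + δ i j * b j)
  ≡⟨ ΣF-cong n (λ j → trans (sym (*-distribʳ-+ (b j) (𝟙 (i ≢ᵇ j)) (δ i j)))
                            (trans (cong (_* b j) (trans (+-comm _ (δ i j)) (δ+≢ᵇ i j))) (*-identityˡ (b j)))) ⟩
    ΣF n b
  ∎
  where open ≡-Reasoning

-- If some bit is clear, every set bit has at most m set partners among the
-- m+2 bits:  Σ_{i≠j} b_i b_j ≤ m · Σ_i b_i.
Σ≠-bits : ∀ m (β : Fin (suc (suc m)) → Bool) (k : Fin (suc (suc m))) → β k ≡ false →
          Σ≠ (suc (suc m)) (λ i j → 𝟙 (β i) * 𝟙 (β j)) ≤ m * ΣF (suc (suc m)) (λ i → 𝟙 (β i))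
Σ≠-bits m β k βk = begin
    Σ≠ n (λ i j → b i * b j)
  ≡⟨ ΣF-cong n (λ i → trans (ΣF-cong n (λ j → *-exchange (𝟙 (i ≢ᵇ j)) (b i) (b j)))
                            (sumL-*ˡ (allFin n) (b i) (λ j → 𝟙 (i ≢ᵇ j) * b j))) ⟩
    ΣF n (λ i → b i * partners i)
  ≤⟨ sumL-mono (allFin n) row ⟩
    ΣF n (λ i → m * b i)
  ≡⟨ sumL-*ˡ (allFin n) m b ⟩
    m * ΣF n b
  ∎
  where
  open ≤-Reasoning
  n : ℕ
  n = suc (suc m)
  b : Fin n → ℕ
  b i = 𝟙 (β i)
  partners : Fin n → ℕ
  partners i = ΣF n (λ j → 𝟙 (i ≢ᵇ j) * b j)
  *-exchange : ∀ a b c → a * (b * c) ≡ b * (a * c)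
  *-exchange = solve-∀
  row : ∀ i → b i * partners i ≤ m * b i
  row i = by-bit (β i) refl
    where
    by-bit : ∀ c → β i ≡ c → b i * partners i ≤ m * b i
    by-bit false βi rewrite βi = z≤n
    by-bit true  βi = subst₂ (λ u v → u * partners i ≤ m * v) (sym (cong 𝟙 βi)) (sym (cong 𝟙 βi))
                             (subst₂ _≤_ (sym (*-identityˡ (partners i))) (sym (*-identityʳ m)) partners≤m)
      where
      -- partners i + 1 is the number of set bits, which is at most m + 1
      partners≤m : partners i ≤ m
      partners≤m = ≤-pred (subst (_≤ suc m)
        (sym (trans (+-comm 1 (partners i)) (trans (cong (partners i +_) (cong 𝟙 (sym βi))) (Σ≢ᵇ+self n b i))))
        (bits-clear≤ (suc m) β k βk))

vec-ext : ∀ {a} {A : Set a} {n} (p q : Vec A n) → (∀ i → lookup p i ≡ lookup q i) → p ≡ q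
vec-ext p q e = trans (sym (tabulate∘lookup p)) (trans (tabulate-cong e) (tabulate∘lookup q))

card-sum : ∀ {n} (p : Subset n) → ∣ p ∣ ≡ ΣF n (λ v → 𝟙 (lookup p v))
card-sum {zero}  []          = refl
card-sum {suc n} (true ∷ p)  = trans (cong suc (card-sum p)) (sym (ΣF-suc n (λ v → 𝟙 (lookup (true ∷ p) v))))
card-sum {suc n} (false ∷ p) = trans (card-sum p) (sym (ΣF-suc n (λ v → 𝟙 (lookup (false ∷ p) v))))

lookup-∪ : ∀ {n} (p q : Subset n) v → lookup (p ∪ q) v ≡ (lookup p v ∨ lookup q v)
lookup-∪ p q v = lookup-zipWith _∨_ v p q

lookup-⁅⁆ : ∀ {n} (x v : Fin n) → lookup ⁅ x ⁆ v ≡ (v ≡ᵇ x)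
lookup-⁅⁆ zero    zero    = refl
lookup-⁅⁆ zero    (suc v) = lookup-replicate v false
lookup-⁅⁆ (suc x) zero    = refl
lookup-⁅⁆ (suc x) (suc v) = lookup-⁅⁆ x v

_≡ˢ_ : ∀ {n} → Subset n → Subset n → Bool
p ≡ˢ q = ⌊ ≡-dec BP._≟_ p q ⌋

≡ˢ-refl : ∀ {n} (p : Subset n) → (p ≡ˢ p) ≡ true
≡ˢ-refl p with ≡-dec BP._≟_ p p
... | yes _  = refl
... | no p≢p = ⊥-elim (p≢p refl)

count-allSubsets : ∀ n (s₀ : Subset n) → sumL (allSubsets n) (λ s → 𝟙 (s₀ ≡ˢ s)) ≡ 1
count-allSubsets zero    []       = refl
count-allSubsets (suc n) (b ∷ s₀) =
  trans (sumL-++ (map (false ∷_) (allSubsets n)) _ _)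
  (trans (cong₂ _+_ (sumL-map (false ∷_) (allSubsets n) _) (sumL-map (true ∷_) (allSubsets n) _))
         (by-head b))
  where
  ≡ˢ-∷ : ∀ (a c : Bool) s → (a ∷ s₀) ≡ˢ (c ∷ s) ≡ (⌊ a BP.≟ c ⌋ ∧ s₀ ≡ˢ s)
  ≡ˢ-∷ a c s with a BP.≟ c | ≡-dec BP._≟_ s₀ s
  ... | yes refl | yes refl = refl
  ... | yes refl | no _     = refl
  ... | no _     | _        = refl
  matching : ∀ a → sumL (allSubsets n) (λ s → 𝟙 ((a ∷ s₀) ≡ˢ (a ∷ s))) ≡ 1
  matching a = trans (sumL-cong (allSubsets n) (λ s → cong 𝟙 (trans (≡ˢ-∷ a a s) (head-eq a))))
                     (count-allSubsets n s₀)
    where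
    head-eq : ∀ a {x} → (⌊ a BP.≟ a ⌋ ∧ x) ≡ x
    head-eq false = refl
    head-eq true  = refl
  mismatching : ∀ a → sumL (allSubsets n) (λ s → 𝟙 ((a ∷ s₀) ≡ˢ (not a ∷ s))) ≡ 0
  mismatching a = sumL-0 (allSubsets n) (λ s → cong 𝟙 (trans (≡ˢ-∷ a (not a) s) (head-neq a)))
    where
    head-neq : ∀ a {x} → (⌊ a BP.≟ not a ⌋ ∧ x) ≡ false
    head-neq false = refl
    head-neq true  = refl
  by-head : ∀ b → sumL (allSubsets n) (λ s → 𝟙 ((b ∷ s₀) ≡ˢ (false ∷ s))) +
                  sumL (allSubsets n) (λ s → 𝟙 ((b ∷ s₀) ≡ˢ (true ∷ s))) ≡ 1
  by-head false = cong₂ _+_ (matching false) (mismatching false)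
  by-head true  = cong₂ _+_ (mismatching true) (matching true)

missing-element : ∀ {n} (S T : Subset n) → ∣ T ∣ < ∣ S ∣ →
                  Σ (Fin n) (λ v → lookup S v ≡ true × lookup T v ≡ false)
missing-element {n} S T |T|<|S| with sumL-pos (allFin n) outside (0<outside)
  where
  outside : Fin n → ℕ
  outside v = 𝟙 (lookup S v) * 𝟙 (not (lookup T v))
  covered : ∀ v → 𝟙 (lookup S v) ≤ 𝟙 (lookup T v) + outside v
  covered v with lookup S v | lookup T v
  ... | true  | true  = s≤s z≤n
  ... | true  | false = s≤s z≤n
  ... | false | _     = z≤n
  0<outside : 0 < ΣF n outside
  0<outside with ΣF n outside in eq
  ... | suc _ = s≤s z≤n
  ... | zero  = ⊥-elim (<⇒≱ |T|<|S| (subst₂ _≤_ (sym (card-sum S))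
                  (trans (sumL-+ (allFin n) (λ v → 𝟙 (lookup T v)) outside)
                         (trans (cong₂ _+_ (sym (card-sum T)) eq) (+-identityʳ ∣ T ∣)))
                  (sumL-mono (allFin n) covered)))
... | v , p = v , 𝟙-pos (proj₁ (pos-* (𝟙 (lookup S v)) _ p)) , not-true (𝟙-pos (proj₂ (pos-* (𝟙 (lookup S v)) _ p)))

⊆-same-size : ∀ {n} {T S : Subset n} → T ⊆ S → ∣ T ∣ ≡ ∣ S ∣ → T ≡ S
⊆-same-size {n} {T} {S} T⊆S |T|≡|S| = vec-ext T S pointwise
  where
  pointwise : ∀ v → lookup T v ≡ lookup S v
  pointwise v with lookup T v in T-v | lookup S v in S-v
  ... | true  | true  = refl
  ... | false | false = refl
  ... | true  | false = ⊥-elim (true≢false (trans (sym ([]=⇒lookup (T⊆S (lookup⇒[]= v T T-v)))) S-v))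
  ... | false | true  = ⊥-elim (<-irrefl |T|≡|S| (p⊂q⇒∣p∣<∣q∣ (T⊆S , v , lookup⇒[]= v S S-v , v∉T)))
    where
    v∉T : ¬ v ∈ T
    v∉T v∈T = true≢false (trans (sym ([]=⇒lookup v∈T)) T-v)

module VectorSums (N : ℕ) where
  allVecs : ∀ m → List (Vec (Fin N) m)
  allVecs zero    = [] ∷ []
  allVecs (suc m) = concatMap (λ x → map (x ∷_) (allVecs m)) (allFin N)

  Σv : ∀ m → (Vec (Fin N) m → ℕ) → ℕ
  Σv m F = sumL (allVecs m) F

  Σv-cong : ∀ m {F G : Vec (Fin N) m → ℕ} → (∀ τ → F τ ≡ G τ) → Σv m F ≡ Σv m G
  Σv-cong m = sumL-cong (allVecs m)

  Σv-suc : ∀ m F → Σv (suc m) F ≡ ΣF N (λ x → Σv m (λ τ → F (x ∷ τ)))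
  Σv-suc m F = trans (sumL-concatMap (λ x → map (x ∷_) (allVecs m)) (allFin N) F)
                     (sumL-cong (allFin N) (λ x → sumL-map (x ∷_) (allVecs m) F))

  Σv-insertAt : ∀ m (i : Fin (suc m)) F → Σv (suc m) F ≡ ΣF N (λ x → Σv m (λ τ → F (insertAt τ i x)))
  Σv-insertAt m       zero    F = Σv-suc m F
  Σv-insertAt (suc m) (suc i) F = begin
      Σv (suc (suc m)) F
    ≡⟨ Σv-suc (suc m) F ⟩
      ΣF N (λ y → Σv (suc m) (λ τ → F (y ∷ τ)))
    ≡⟨ ΣF-cong N (λ y → Σv-insertAt m i (λ τ → F (y ∷ τ))) ⟩
      ΣF N (λ y → ΣF N (λ x → Σv m (λ σ → F (y ∷ insertAt σ i x))))
    ≡⟨ sumL-swap (allFin N) (allFin N) _ ⟩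
      ΣF N (λ x → ΣF N (λ y → Σv m (λ σ → F (y ∷ insertAt σ i x))))
    ≡⟨ ΣF-cong N (λ x → sym (Σv-suc m (λ τ → F (insertAt τ (suc i) x)))) ⟩
      ΣF N (λ x → Σv (suc m) (λ τ → F (insertAt τ (suc i) x)))
    ∎
    where open ≡-Reasoning

  ∈-allVecs : ∀ m (τ : Vec (Fin N) m) → τ LM.∈ allVecs m
  ∈-allVecs zero    []      = here refl
  ∈-allVecs (suc m) (x ∷ τ) = in-block (allFin N) (∈-allFin x)
    where
    in-block : ∀ xs → x LM.∈ xs → (x ∷ τ) LM.∈ concatMap (λ x → map (x ∷_) (allVecs m)) xs
    in-block (y ∷ xs) (here refl) = ∈-++⁺ˡ (∈-map⁺ (x ∷_) (∈-allVecs m τ))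
    in-block (y ∷ xs) (there p)   = ∈-++⁺ʳ (map (y ∷_) (allVecs m)) (in-block xs p)

lookup-insertAt-≢ : ∀ {a} {A : Set a} {m} (τ : Vec A m) (i : Fin (suc m)) x c (i≢c : ¬ i ≡ c) →
  lookup (insertAt τ i x) c ≡ lookup τ (punchOut i≢c)
lookup-insertAt-≢ τ i x c i≢c =
  trans (cong (lookup (insertAt τ i x)) (sym (punchIn-punchOut i≢c))) (insertAt-punchIn τ i x (punchOut i≢c))

module Transversals (q : ℕ) (G : PartiteGraph (suc (suc q))) where
  open PartiteGraph G
  open VectorSums N public

  r M : ℕ
  r = suc (suc q)
  M = suc r

  size : Fin M → ℕ
  size k = ΣF N (λ x → δ (class x) k)

  size≡classSize : ∀ k → classSize G k ≡ size k
  size≡classSize k = trans (length-filterᵇ (allFin N) _)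
                           (sumL-cong (allFin N) (λ x → cong 𝟙 (⌊≟⌋≡≡ᵇ (class x) k)))

  fits : ∀ m → (Fin m → Fin M) → Vec (Fin N) m → ℕ
  fits m tgt τ = ΠF m (λ c → δ (class (lookup τ c)) (tgt c))

  fits-insertAt : ∀ m tgt (τ : Vec (Fin N) m) i x →
    fits (suc m) tgt (insertAt τ i x) ≡ δ (class x) (tgt i) * fits m (λ c → tgt (punchIn i c)) τ
  fits-insertAt m tgt τ i x =
    trans (ΠF-punchIn m i (λ c → δ (class (lookup (insertAt τ i x) c)) (tgt c)))
          (cong₂ _*_ (cong (λ y → δ (class y) (tgt i)) (insertAt-lookup τ i x))
                     (ΠF-cong m (λ c → cong (λ y → δ (class y) (tgt (punchIn i c))) (insertAt-punchIn τ i x c))))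

  Σv-fits : ∀ m tgt → Σv m (fits m tgt) ≡ ΠF m (λ c → size (tgt c))
  Σv-fits zero    tgt = refl
  Σv-fits (suc m) tgt = begin
      Σv (suc m) (fits (suc m) tgt)
    ≡⟨ Σv-suc m (fits (suc m) tgt) ⟩
      ΣF N (λ x → Σv m (λ τ → fits (suc m) tgt (x ∷ τ)))
    ≡⟨ ΣF-cong N (λ x → trans (Σv-cong m (λ τ → ΠF-suc m (λ c → δ (class (lookup (x ∷ τ) c)) (tgt c))))
                              (sumL-*ˡ (allVecs m) (δ (class x) (tgt zero)) (fits m tgt′))) ⟩
      ΣF N (λ x → δ (class x) (tgt zero) * Σv m (fits m tgt′))
    ≡⟨ sumL-*ʳ (allFin N) (Σv m (fits m tgt′)) (λ x → δ (class x) (tgt zero)) ⟩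
      size (tgt zero) * Σv m (fits m tgt′)
    ≡⟨ cong (size (tgt zero) *_) (Σv-fits m tgt′) ⟩
      size (tgt zero) * ΠF m (λ c → size (tgt′ c))
    ≡⟨ sym (ΠF-suc m (λ c → size (tgt c))) ⟩
      ΠF (suc m) (λ c → size (tgt c))
    ∎
    where
    open ≡-Reasoning
    tgt′ : Fin m → Fin M
    tgt′ c = tgt (suc c)

  fits-bit : ∀ m tgt τ → fits m tgt τ ≡ 0 ⊎ (fits m tgt τ ≡ 1 × (∀ c → class (lookup τ c) ≡ tgt c))
  fits-bit m tgt τ with ΠF-bits m (λ c → δ (class (lookup τ c)) (tgt c)) (λ c → δ≤1 (class (lookup τ c)) (tgt c))
  ... | inj₁ (p , _) = inj₁ p
  ... | inj₂ (p , h) = inj₂ (p , λ c → δ-pos (subst (0 <_) (sym (h c)) (s≤s z≤n)))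

  -- W t = 1 iff t is a transversal (t(c) ∈ V_c for every class c); Π counts them
  W : Vec (Fin N) M → ℕ
  W = fits M (λ c → c)

  Π : ℕ
  Π = Σv M W

  W-transversal : ∀ t → 0 < W t → ∀ c → class (lookup t c) ≡ c
  W-transversal t W>0 with fits-bit M (λ c → c) t
  ... | inj₁ W≡0     = ⊥-elim (<-irrefl (sym W≡0) W>0)
  ... | inj₂ (_ , h) = h

  span : (Fin M → Bool) → Vec (Fin N) M → Subset N
  span keep t = V.tabulate (λ v → keep (class v) ∧ lookup t (class v) ≡ᵇ v)

  lookup-span : ∀ keep t v → lookup (span keep t) v ≡ (keep (class v) ∧ lookup t (class v) ≡ᵇ v)
  lookup-span keep t v = lookup∘tabulate _ v

  span-cong : ∀ {keep keep′} t → (∀ c → keep c ≡ keep′ c) → span keep t ≡ span keep′ t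
  span-cong t h = tabulate-cong (λ v → cong (λ b → b ∧ _) (h _))

  card-span : ∀ keep t → (∀ c → class (lookup t c) ≡ c) → ∣ span keep t ∣ ≡ ΣF M (λ c → 𝟙 (keep c))
  card-span keep t tr = begin
      ∣ span keep t ∣
    ≡⟨ card-sum (span keep t) ⟩
      ΣF N (λ v → 𝟙 (lookup (span keep t) v))
    ≡⟨ ΣF-cong N (λ v → trans (cong 𝟙 (lookup-span keep t v))
         (trans (𝟙-∧ (keep (class v)) _) (sym (sum-delta′ (class v) (λ c → 𝟙 (keep c) * δ (lookup t c) v))))) ⟩
      ΣF N (λ v → ΣF M (λ c → δ c (class v) * (𝟙 (keep c) * δ (lookup t c) v)))
    ≡⟨ sumL-swap (allFin N) (allFin M) _ ⟩
      ΣF M (λ c → ΣF N (λ v → δ c (class v) * (𝟙 (keep c) * δ (lookup t c) v)))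
    ≡⟨ ΣF-cong M (λ c → trans (ΣF-cong N (λ v → rearrange (δ c (class v)) (𝟙 (keep c)) (δ (lookup t c) v)))
         (trans (sumL-*ˡ (allFin N) (𝟙 (keep c)) (λ v → δ (lookup t c) v * δ c (class v)))
                (cong (𝟙 (keep c) *_) (sum-delta (lookup t c) (λ v → δ c (class v)))))) ⟩
      ΣF M (λ c → 𝟙 (keep c) * δ c (class (lookup t c)))
    ≡⟨ ΣF-cong M (λ c → trans (cong (λ z → 𝟙 (keep c) * δ c z) (tr c))
                              (trans (cong (𝟙 (keep c) *_) (δ-refl c)) (*-identityʳ (𝟙 (keep c))))) ⟩
      ΣF M (λ c → 𝟙 (keep c))
    ∎
    where
    open ≡-Reasoning
    rearrange : ∀ a b c → a * (b * c) ≡ b * (c * a)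
    rearrange = solve-∀

  -- face k t = 1 iff the r vertices of t outside class k form an edge
  face : Fin M → Vec (Fin N) M → ℕ
  face k t = 𝟙 (edge (span (_≢ᵇ k) t))

  E : Fin M → ℕ
  E k = Σv M (λ t → W t * face k t)

-- Step (1): the density hypothesis bounds every E_k from below.
module Density (q : ℕ) (G : PartiteGraph (suc (suc q))) where
  open PartiteGraph G
  open Transversals q G

  avoids-class : ∀ k s → avoidsᵇ G k s ≡ true → ∀ v → lookup s v ≡ true → (class v ≡ᵇ k) ≡ false
  avoids-class k s avoids v v∈s = not-true (trans (cong₂ (λ a b → not a ∨ not b) (sym v∈s) (sym (⌊≟⌋≡≡ᵇ (class v) k)))
    (all-true (λ v → not (lookup s v) ∨ not ⌊ class v ≟ k ⌋) (allFin N) avoids (∈-allFin v)))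

  inClass : Subset N → Fin M → ℕ
  inClass s c = ΣF N (λ v → δ (class v) c * 𝟙 (lookup s v))

  Σ-inClass : ∀ s → ΣF M (inClass s) ≡ ∣ s ∣
  Σ-inClass s = sym (trans (card-sum s)
    (trans (ΣF-cong N (λ v → sym (sum-delta (class v) (λ _ → 𝟙 (lookup s v)))))
           (sumL-swap (allFin N) (allFin M) (λ v c → δ (class v) c * 𝟙 (lookup s v)))))

  inClass≤1 : ∀ s → edge s ≡ true → ∀ c → inClass s c ≤ 1
  inClass≤1 s s-edge c = ΣF-at-most-one N (λ v → δ (class v) c * 𝟙 (lookup s v))
    (λ v → *-mono-≤ (δ≤1 (class v) c) (𝟙≤1 (lookup s v)))
    (λ u v pu pv → let (cu , u∈s) = pos-* (δ (class u) c) _ pu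
                       (cv , v∈s) = pos-* (δ (class v) c) _ pv
                   in partite s s-edge u v (lookup⇒[]= u s (𝟙-pos u∈s)) (lookup⇒[]= v s (𝟙-pos v∈s))
                              (trans (δ-pos cu) (sym (δ-pos cv))))

  inClass-avoided : ∀ k s → avoidsᵇ G k s ≡ true → inClass s k ≡ 0
  inClass-avoided k s avoids = sumL-0 (allFin N) term
    where
    term : ∀ v → δ (class v) k * 𝟙 (lookup s v) ≡ 0
    term v with lookup s v in v∈s
    ... | false = *-zeroʳ (δ (class v) k)
    ... | true  = cong (λ z → 𝟙 z * 1) (avoids-class k s avoids v v∈s)

  -- an edge of P_k (r vertices, at most one per class, none in V_k) has a
  -- vertex in every class c ≠ k
  edge-meets-class : ∀ k s → edge s ≡ true → avoidsᵇ G k s ≡ true → ∀ c → ¬ c ≡ k →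
                     Σ (Fin N) (λ v → lookup s v ≡ true × class v ≡ c)
  edge-meets-class k s s-edge avoids c c≢k with inClass s c in eq
  ... | suc _ = let (v , p)     = sumL-pos (allFin N) (λ v → δ (class v) c * 𝟙 (lookup s v))
                                            (subst (0 <_) (sym eq) (s≤s z≤n))
                    (cv , v∈s) = pos-* (δ (class v) c) _ p
                in v , 𝟙-pos v∈s , δ-pos cv
  ... | zero  = ⊥-elim (1+n≰n (subst₂ _≤_ total (ΣF-1 M) (sumL-mono (allFin M) bounded)))
    where
    -- classes k and c carry no vertex of s, so we may add δ·k + δ·c and stay ≤ 1
    padded : Fin M → ℕ
    padded c′ = inClass s c′ + (δ c′ k + δ c′ c)
    bounded : ∀ c′ → padded c′ ≤ 1
    bounded c′ with c′ ≟ k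
    ... | yes refl rewrite inClass-avoided k s avoids | δ-refl k | δ-≢ (λ e → c≢k (sym e)) = ≤-refl
    ... | no c′≢k with c′ ≟ c
    ...   | yes refl rewrite eq | δ-refl c | δ-≢ c≢k = ≤-refl
    ...   | no c′≢c rewrite δ-≢ c′≢k | δ-≢ c′≢c = subst (_≤ 1) (sym (+-identityʳ _)) (inClass≤1 s s-edge c′)
    total : ΣF M padded ≡ suc M
    total = trans (sumL-+ (allFin M) (inClass s) (λ c′ → δ c′ k + δ c′ c))
            (trans (cong₂ _+_ (trans (Σ-inClass s) (uniform s s-edge))
                              (trans (sumL-+ (allFin M) (λ c′ → δ c′ k) (λ c′ → δ c′ c))
                                     (cong₂ _+_ (ΣF-δ k) (ΣF-δ c))))
            (+-comm r 2))

  edgesP-as-sum : ∀ k → edgesP G k ≡ sumL (allSubsets N) (λ s → 𝟙 (edge s ∧ avoidsᵇ G k s))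
  edgesP-as-sum k = length-filterᵇ (allSubsets N) (λ s → edge s ∧ avoidsᵇ G k s)

  another : Fin M → Fin M
  another zero    = suc zero
  another (suc _) = zero

  another≢ : ∀ k → ¬ k ≡ another k
  another≢ zero    ()
  another≢ (suc k) ()

  -- every class is nonempty: P_c has an edge for c ≠ k, and it meets V_k
  class-nonempty : (∀ i → DensityAbove G i) → ∀ k → 0 < size k
  class-nonempty dens k = from-edge (edgesP G c) refl
    where
    c : Fin M
    c = another k
    from-edge : ∀ m → edgesP G c ≡ m → 0 < size k
    from-edge zero    eq = ⊥-elim (n≮0 (subst (suc q * prodOthers G c <_)
                                           (trans (cong (r *_) eq) (*-zeroʳ r)) (dens c)))
    from-edge (suc _) eq =
      let (s , p)           = sumL-pos (allSubsets N) (λ s → 𝟙 (edge s ∧ avoidsᵇ G c s))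
                                       (subst (0 <_) (trans (sym eq) (edgesP-as-sum c)) (s≤s z≤n))
          (s-edge , avoids) = ∧-split (𝟙-pos p)
          (v , _ , cv)      = edge-meets-class c s s-edge avoids k (another≢ k)
      in ≤-trans (≤-reflexive (sym (trans (cong (λ z → δ z k) cv) (δ-refl k))))
                 (sumL-term (λ x → δ (class x) k) (∈-allFin v))

  rep : (∀ i → DensityAbove G i) → Fin M → Fin N
  rep dens k = proj₁ (sumL-pos (allFin N) (λ x → δ (class x) k) (class-nonempty dens k))

  rep-class : ∀ dens k → class (rep dens k) ≡ k
  rep-class dens k = δ-pos (proj₂ (sumL-pos (allFin N) (λ x → δ (class x) k) (class-nonempty dens k)))

  span-on-edge : ∀ k s → edge s ≡ true → avoidsᵇ G k s ≡ true → ∀ t →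
    (∀ c → ¬ k ≡ c → lookup s (lookup t c) ≡ true × class (lookup t c) ≡ c) →
    span (_≢ᵇ k) t ≡ s
  span-on-edge k s s-edge avoids t on-s = vec-ext _ _ same-members
    where
    at : Fin N → Bool
    at v = lookup t (class v) ≡ᵇ v
    same-members : ∀ v → lookup (span (_≢ᵇ k) t) v ≡ lookup s v
    same-members v with class v ≟ k
    ... | yes cv≡k = trans (lookup-span (_≢ᵇ k) t v)
                           (trans (cong (λ z → not (z ≡ᵇ k) ∧ at v) cv≡k)
                                  (trans (cong (λ b → not b ∧ at v) (≡ᵇ-refl k)) (sym v∉s)))
      where
      v∉s : lookup s v ≡ false
      v∉s with lookup s v in v∈s
      ... | false = refl
      ... | true  = ⊥-elim (true≢false (trans (sym (trans (cong (_≡ᵇ k) cv≡k) (≡ᵇ-refl k)))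
                                              (avoids-class k s avoids v v∈s)))
    ... | no cv≢k = trans (lookup-span (_≢ᵇ k) t v)
                          (trans (cong (λ b → not b ∧ at v) (≡ᵇ-≢ cv≢k)) picked≡v)
      where
      w : Fin N
      w = lookup t (class v)
      w∈s : lookup s w ≡ true
      w∈s = proj₁ (on-s (class v) (λ e → cv≢k (sym e)))
      class-w : class w ≡ class v
      class-w = proj₂ (on-s (class v) (λ e → cv≢k (sym e)))
      -- v ∈ s iff v is the picked vertex w, since s has one vertex per class
      picked≡v : (w ≡ᵇ v) ≡ lookup s v
      picked≡v with w ≡ᵇ v in w≡v
      ... | true = trans (sym w∈s) (cong (lookup s) (≡ᵇ-sound w≡v))
      ... | false with lookup s v in v∈s
      ...   | false = refl
      ...   | true  = ⊥-elim (true≢false (trans (sym (≡ᵇ-refl w))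
                (trans (cong (w ≡ᵇ_) (partite s s-edge w v (lookup⇒[]= w s w∈s) (lookup⇒[]= v s v∈s) class-w)) w≡v)))

  -- Every edge s of P_k is a face: choosing its vertex in each class c ≠ k
  -- gives τ whose face opposite k, after inserting any x at k, is s.
  edge-as-face : ∀ k s → edge s ≡ true → avoidsᵇ G k s ≡ true → ∀ x →
    Σ (Vec (Fin N) r) (λ τ → fits r (punchIn k) τ ≡ 1 × span (_≢ᵇ k) (insertAt τ k x) ≡ s)
  edge-as-face k s s-edge avoids x = τ , τ-fits , span-on-edge k s s-edge avoids (insertAt τ k x) on-s
    where
    choice : ∀ c → Σ (Fin N) (λ v → lookup s v ≡ true × class v ≡ punchIn k c)
    choice c = edge-meets-class k s s-edge avoids (punchIn k c) (punchInᵢ≢i k c)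
    τ : Vec (Fin N) r
    τ = V.tabulate (λ c → proj₁ (choice c))
    τ-at : ∀ c → lookup τ c ≡ proj₁ (choice c)
    τ-at = lookup∘tabulate (λ c → proj₁ (choice c))
    τ-fits : fits r (punchIn k) τ ≡ 1
    τ-fits = ΠF-1 r _ (λ c → trans (cong (λ z → δ (class z) (punchIn k c)) (τ-at c))
                                   (trans (cong (λ z → δ z (punchIn k c)) (proj₂ (proj₂ (choice c))))
                                          (δ-refl (punchIn k c))))
    on-s : ∀ c → ¬ k ≡ c → lookup s (lookup (insertAt τ k x) c) ≡ true × class (lookup (insertAt τ k x) c) ≡ c
    on-s c k≢c rewrite lookup-insertAt-≢ τ k x c k≢c | τ-at (punchOut k≢c) =
      proj₁ (proj₂ (choice (punchOut k≢c))) , trans (proj₂ (proj₂ (choice (punchOut k≢c)))) (punchIn-punchOut k≢c)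

  edges≤faces-through : ∀ k x →
    edgesP G k ≤ Σv r (λ τ → fits r (punchIn k) τ * face k (insertAt τ k x))
  edges≤faces-through k x = begin
      edgesP G k
    ≡⟨ edgesP-as-sum k ⟩
      sumL (allSubsets N) (λ s → 𝟙 (edge s ∧ avoidsᵇ G k s))
    ≤⟨ sumL-mono (allSubsets N) hit ⟩
      sumL (allSubsets N) (λ s → Σv r (λ τ → F τ * 𝟙 (spanAt τ ≡ˢ s)))
    ≡⟨ sumL-swap (allSubsets N) (allVecs r) (λ s τ → F τ * 𝟙 (spanAt τ ≡ˢ s)) ⟩
      Σv r (λ τ → sumL (allSubsets N) (λ s → F τ * 𝟙 (spanAt τ ≡ˢ s)))
    ≡⟨ Σv-cong r (λ τ → trans (sumL-*ˡ (allSubsets N) (F τ) (λ s → 𝟙 (spanAt τ ≡ˢ s)))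
                              (trans (cong (F τ *_) (count-allSubsets N (spanAt τ))) (*-identityʳ (F τ)))) ⟩
      Σv r F
    ∎
    where
    open ≤-Reasoning
    spanAt : Vec (Fin N) r → Subset N
    spanAt τ = span (_≢ᵇ k) (insertAt τ k x)
    F : Vec (Fin N) r → ℕ
    F τ = fits r (punchIn k) τ * face k (insertAt τ k x)
    hit : ∀ s → 𝟙 (edge s ∧ avoidsᵇ G k s) ≤ Σv r (λ τ → F τ * 𝟙 (spanAt τ ≡ˢ s))
    hit s with edge s in s-edge | avoidsᵇ G k s in avoids
    ... | false | _     = z≤n
    ... | true  | false = z≤n
    ... | true  | true  with edge-as-face k s s-edge avoids x
    ...   | τ , τ-fits , span≡s =
      ≤-trans (≤-reflexive (sym term≡1)) (sumL-term (λ τ → F τ * 𝟙 (spanAt τ ≡ˢ s)) (∈-allVecs r τ))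
      where
      term≡1 : F τ * 𝟙 (spanAt τ ≡ˢ s) ≡ 1
      term≡1 rewrite τ-fits | span≡s | s-edge | ≡ˢ-refl s = refl

  edges≤faces : ∀ k → size k * edgesP G k ≤ E k
  edges≤faces k = begin
      size k * edgesP G k
    ≡⟨ sym (sumL-*ʳ (allFin N) (edgesP G k) (λ x → δ (class x) k)) ⟩
      ΣF N (λ x → δ (class x) k * edgesP G k)
    ≤⟨ sumL-mono (allFin N) (λ x → *-monoʳ-≤ (δ (class x) k) (edges≤faces-through k x)) ⟩
      ΣF N (λ x → δ (class x) k * Σv r (λ τ → fits r (punchIn k) τ * face k (insertAt τ k x)))
    ≡⟨ ΣF-cong N (λ x → trans (sym (sumL-*ˡ (allVecs r) (δ (class x) k) _))
          (Σv-cong r (λ τ → trans (sym (*-assoc (δ (class x) k) (fits r (punchIn k) τ) _))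
             (cong (_* face k (insertAt τ k x)) (sym (fits-insertAt r (λ c → c) τ k x)))))) ⟩
      ΣF N (λ x → Σv r (λ τ → W (insertAt τ k x) * face k (insertAt τ k x)))
    ≡⟨ sym (Σv-insertAt r k (λ t → W t * face k t)) ⟩
      E k
    ∎
    where open ≤-Reasoning

  Π≡size*prodOthers : ∀ k → Π ≡ size k * prodOthers G k
  Π≡size*prodOthers k = begin
      Π
    ≡⟨ Σv-fits M (λ c → c) ⟩
      ΠF M size
    ≡⟨ ΠF-punchIn r k size ⟩
      size k * ΠF r (λ c → size (punchIn k c))
    ≡⟨ cong (size k *_) (sym others) ⟩
      size k * prodOthers G k
    ∎
    where
    open ≡-Reasoning
    others : prodOthers G k ≡ ΠF r (λ c → size (punchIn k c))
    others = begin
        prodOthers G k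
      ≡⟨ product-filter (classSize G) (λ j → not ⌊ j ≟ k ⌋) (allFin M) ⟩
        ΠF M (λ c → if not ⌊ c ≟ k ⌋ then classSize G c else 1)
      ≡⟨ ΠF-cong M (λ c → cong₂ (λ b z → if not b then z else 1) (⌊≟⌋≡≡ᵇ c k) (size≡classSize c)) ⟩
        ΠF M (λ c → if c ≢ᵇ k then size c else 1)
      ≡⟨ ΠF-punchIn r k (λ c → if c ≢ᵇ k then size c else 1) ⟩
        (if k ≢ᵇ k then size k else 1) * ΠF r (λ c → if punchIn k c ≢ᵇ k then size (punchIn k c) else 1)
      ≡⟨ cong₂ _*_ (cong (λ b → if not b then size k else 1) (≡ᵇ-refl k))
                   (ΠF-cong r (λ c → cong (λ b → if not b then size (punchIn k c) else 1)
                                          (≡ᵇ-≢ (punchInᵢ≢i k c)))) ⟩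
        1 * ΠF r (λ c → size (punchIn k c))
      ≡⟨ *-identityˡ _ ⟩
        ΠF r (λ c → size (punchIn k c))
      ∎

  density-faces : (∀ i → DensityAbove G i) → ∀ k → suc q * Π < r * E k
  density-faces dens k = begin-strict
      suc q * Π
    ≡⟨ cong (suc q *_) (Π≡size*prodOthers k) ⟩
      suc q * (size k * prodOthers G k)
    ≡⟨ reorderˡ (suc q) (size k) (prodOthers G k) ⟩
      suc q * prodOthers G k * size k
    <⟨ *-monoˡ-< (size k) {{>-nonZero (class-nonempty dens k)}} (dens k) ⟩
      r * edgesP G k * size k
    ≡⟨ reorderʳ r (edgesP G k) (size k) ⟩
      r * (size k * edgesP G k)
    ≤⟨ *-monoʳ-≤ r (edges≤faces k) ⟩
      r * E k
    ∎
    where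
    open ≤-Reasoning
    reorderˡ : ∀ a b c → a * (b * c) ≡ a * c * b
    reorderˡ = solve-∀
    reorderʳ : ∀ a b c → a * b * c ≡ a * (c * b)
    reorderʳ = solve-∀

-- Step (2): the pair inequality E_i·E_j ≤ Π·P_ij for i ≠ j.
module PairInequality (q : ℕ) (G : PartiteGraph (suc (suc q))) where
  open PartiteGraph G
  open Transversals q G
  open Density q G

  P : Fin M → Fin M → ℕ
  P i j = Σv M (λ t → W t * (face i t * face j t))

  span-drop-one : ∀ (a b : Fin M) → ¬ a ≡ b → ∀ t t′ z → lookup t b ≡ z → class z ≡ b →
    (∀ c → ¬ c ≡ a → ¬ c ≡ b → lookup t c ≡ lookup t′ c) →
    span (_≢ᵇ a) t ≡ span (λ c → c ≢ᵇ a ∧ c ≢ᵇ b) t′ ∪ ⁅ z ⁆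
  span-drop-one a b a≢b t t′ z t-at-b class-z agree = vec-ext _ _ pointwise
    where
    pointwise : ∀ v → lookup (span (_≢ᵇ a) t) v ≡ lookup (span (λ c → c ≢ᵇ a ∧ c ≢ᵇ b) t′ ∪ ⁅ z ⁆) v
    pointwise v rewrite lookup-span (_≢ᵇ a) t v | lookup-∪ (span (λ c → c ≢ᵇ a ∧ c ≢ᵇ b) t′) ⁅ z ⁆ v
                      | lookup-span (λ c → c ≢ᵇ a ∧ c ≢ᵇ b) t′ v | lookup-⁅⁆ z v with class v ≟ a
    ... | yes refl rewrite ≡ᵇ-refl (class v)
                         | ≡ᵇ-≢ {a = v} {b = z} (λ v≡z → a≢b (trans (cong class v≡z) class-z)) = refl
    ... | no cv≢a rewrite ≡ᵇ-≢ cv≢a with class v ≟ b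
    ...   | yes refl rewrite ≡ᵇ-refl (class v) | t-at-b | ≡ᵇ-sym z v = refl
    ...   | no cv≢b rewrite ≡ᵇ-≢ cv≢b | agree (class v) cv≢a cv≢b
                          | ≡ᵇ-≢ {a = v} {b = z} (λ v≡z → cv≢b (trans (cong class v≡z) class-z)) =
      sym (BP.∨-identityʳ _)

  deg-as-sum : ∀ k S → deg G k S ≡ ΣF N (λ v → δ (class v) k * 𝟙 (edge (S ∪ ⁅ v ⁆)))
  deg-as-sum k S = trans (length-filterᵇ (allFin N) (λ v → ⌊ class v ≟ k ⌋ ∧ edge (S ∪ ⁅ v ⁆)))
    (sumL-cong (allFin N) (λ v → trans (𝟙-∧ _ (edge (S ∪ ⁅ v ⁆)))
                                       (cong (λ b → 𝟙 b * 𝟙 (edge (S ∪ ⁅ v ⁆))) (⌊≟⌋≡≡ᵇ (class v) k))))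

  -- Fix i and j = punchIn i j′ ≠ i.  A transversal is split into its vertices
  -- x ∈ V_i, y ∈ V_j and the remaining r-1 coordinates σ.
  module ForPair (bal : AllStrictlyBalanced G) (dens : ∀ i → DensityAbove G i)
                 (i : Fin M) (j′ : Fin r) where
    j : Fin M
    j = punchIn i j′

    i≢j : ¬ i ≡ j
    i≢j e = punchInᵢ≢i i j′ (sym e)

    join : Vec (Fin N) (suc q) → Fin N → Fin N → Vec (Fin N) M
    join σ x y = insertAt (insertAt σ j′ y) i x

    Σv-join : ∀ F → Σv M F ≡ Σv (suc q) (λ σ → ΣF N (λ x → ΣF N (λ y → F (join σ x y))))
    Σv-join F =
      trans (Σv-insertAt r i F)
      (trans (ΣF-cong N (λ x → Σv-insertAt (suc q) j′ (λ τ → F (insertAt τ i x))))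
      (trans (ΣF-cong N (λ x → sumL-swap (allFin N) (allVecs (suc q)) (λ y σ → F (join σ x y))))
             (sumL-swap (allFin N) (allVecs (suc q)) (λ x σ → ΣF N (λ y → F (join σ x y))))))

    fitsσ : Vec (Fin N) (suc q) → ℕ
    fitsσ = fits (suc q) (λ c → punchIn i (punchIn j′ c))

    W-join : ∀ σ x y → W (join σ x y) ≡ δ (class x) i * (δ (class y) j * fitsσ σ)
    W-join σ x y = trans (fits-insertAt r (λ c → c) (insertAt σ j′ y) i x)
                         (cong (δ (class x) i *_) (fits-insertAt (suc q) (punchIn i) σ j′ y))

    join-at-i : ∀ σ x y → lookup (join σ x y) i ≡ x
    join-at-i σ x y = insertAt-lookup (insertAt σ j′ y) i x

    join-at-j : ∀ σ x y → lookup (join σ x y) j ≡ y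
    join-at-j σ x y = trans (insertAt-punchIn (insertAt σ j′ y) i x j′) (insertAt-lookup σ j′ y)

    join-elsewhere : ∀ σ x y x′ y′ c → ¬ c ≡ i → ¬ c ≡ j → lookup (join σ x y) c ≡ lookup (join σ x′ y′) c
    join-elsewhere σ x y x′ y′ c c≢i c≢j =
      trans (lookup-insertAt-≢ (insertAt σ j′ y) i x c i≢c)
      (trans (lookup-insertAt-≢ σ j′ y c′ j′≢c′)
      (sym (trans (lookup-insertAt-≢ (insertAt σ j′ y′) i x′ c i≢c) (lookup-insertAt-≢ σ j′ y′ c′ j′≢c′))))
      where
      i≢c : ¬ i ≡ c
      i≢c e = c≢i (sym e)
      c′ : Fin r
      c′ = punchOut i≢c
      j′≢c′ : ¬ j′ ≡ c′
      j′≢c′ e = c≢j (trans (sym (punchIn-punchOut i≢c)) (cong (punchIn i) (sym e)))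

    anchor : Vec (Fin N) (suc q) → Vec (Fin N) M
    anchor σ = join σ (rep dens i) (rep dens j)

    others : Fin M → Bool
    others c = c ≢ᵇ i ∧ c ≢ᵇ j

    base : Vec (Fin N) (suc q) → Subset N
    base σ = span others (anchor σ)

    extends : Vec (Fin N) (suc q) → Fin N → ℕ
    extends σ z = 𝟙 (edge (base σ ∪ ⁅ z ⁆))

    Dᵢ Dⱼ : Vec (Fin N) (suc q) → ℕ
    Dᵢ σ = ΣF N (λ x → δ (class x) i * extends σ x)
    Dⱼ σ = ΣF N (λ y → δ (class y) j * extends σ y)

    face-i : ∀ σ x y → class y ≡ j → face i (join σ x y) ≡ extends σ y
    face-i σ x y cy = cong (λ s → 𝟙 (edge s))
      (span-drop-one i j i≢j (join σ x y) (anchor σ) y (join-at-j σ x y) cy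
                     (λ c c≢i c≢j → join-elsewhere σ x y (rep dens i) (rep dens j) c c≢i c≢j))

    face-j : ∀ σ x y → class x ≡ i → face j (join σ x y) ≡ extends σ x
    face-j σ x y cx = cong (λ s → 𝟙 (edge s))
      (trans (span-drop-one j i (λ e → i≢j (sym e)) (join σ x y) (anchor σ) x (join-at-i σ x y) cx
                            (λ c c≢j c≢i → join-elsewhere σ x y (rep dens i) (rep dens j) c c≢i c≢j))
             (cong (_∪ ⁅ x ⁆) (span-cong (anchor σ) (λ c → BP.∧-comm (c ≢ᵇ j) (c ≢ᵇ i)))))

    -- on the support of W, face i only sees y and face j only sees x
    masked-face-i : ∀ σ x y → δ (class y) j * face i (join σ x y) ≡ δ (class y) j * extends σ y
    masked-face-i σ x y with class y ≟ j
    ... | yes cy  = cong (δ (class y) j *_) (face-i σ x y cy)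
    ... | no cy≢j rewrite δ-≢ cy≢j = refl

    masked-face-j : ∀ σ x y → δ (class x) i * face j (join σ x y) ≡ δ (class x) i * extends σ x
    masked-face-j σ x y with class x ≟ i
    ... | yes cx  = cong (δ (class x) i *_) (face-j σ x y cx)
    ... | no cx≢i rewrite δ-≢ cx≢i = refl

    Σxy : (Vec (Fin N) (suc q) → Fin N → Fin N → ℕ) → Vec (Fin N) (suc q) → ℕ
    Σxy F σ = ΣF N (λ x → ΣF N (λ y → F σ x y))

    Σxy-W : ∀ σ → Σxy (λ σ x y → W (join σ x y)) σ ≡ fitsσ σ * (size i * size j)
    Σxy-W σ = trans (ΣF-cong N (λ x → ΣF-cong N (λ y → trans (W-join σ x y)
                      (reorder (δ (class x) i) (δ (class y) j) (fitsσ σ)))))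
                    (sumL-factor (allFin N) (fitsσ σ) (λ x → δ (class x) i) (λ y → δ (class y) j))
      where
      reorder : ∀ a b w → a * (b * w) ≡ w * (a * b)
      reorder = solve-∀

    Σxy-face-i : ∀ σ → Σxy (λ σ x y → W (join σ x y) * face i (join σ x y)) σ ≡ fitsσ σ * (size i * Dⱼ σ)
    Σxy-face-i σ = trans (ΣF-cong N (λ x → ΣF-cong N (λ y → term x y)))
                         (sumL-factor (allFin N) (fitsσ σ) (λ x → δ (class x) i) (λ y → δ (class y) j * extends σ y))
      where
      reorder : ∀ a b w f → a * (b * w) * f ≡ w * (a * (b * f))
      reorder = solve-∀
      term : ∀ x y → W (join σ x y) * face i (join σ x y) ≡ fitsσ σ * (δ (class x) i * (δ (class y) j * extends σ y))
      term x y = trans (cong (_* face i (join σ x y)) (W-join σ x y))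
                       (trans (reorder (δ (class x) i) (δ (class y) j) (fitsσ σ) (face i (join σ x y)))
                              (cong (λ z → fitsσ σ * (δ (class x) i * z)) (masked-face-i σ x y)))

    Σxy-face-j : ∀ σ → Σxy (λ σ x y → W (join σ x y) * face j (join σ x y)) σ ≡ fitsσ σ * (Dᵢ σ * size j)
    Σxy-face-j σ = trans (ΣF-cong N (λ x → ΣF-cong N (λ y → term x y)))
                         (sumL-factor (allFin N) (fitsσ σ) (λ x → δ (class x) i * extends σ x) (λ y → δ (class y) j))
      where
      reorder : ∀ a b w f → a * (b * w) * f ≡ w * (a * f * b)
      reorder = solve-∀
      term : ∀ x y → W (join σ x y) * face j (join σ x y) ≡ fitsσ σ * (δ (class x) i * extends σ x * δ (class y) j)
      term x y = trans (cong (_* face j (join σ x y)) (W-join σ x y))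
                       (trans (reorder (δ (class x) i) (δ (class y) j) (fitsσ σ) (face j (join σ x y)))
                              (cong (λ z → fitsσ σ * (z * δ (class y) j)) (masked-face-j σ x y)))

    Σxy-faces : ∀ σ → Σxy (λ σ x y → W (join σ x y) * (face i (join σ x y) * face j (join σ x y))) σ
                      ≡ fitsσ σ * (Dᵢ σ * Dⱼ σ)
    Σxy-faces σ = trans (ΣF-cong N (λ x → ΣF-cong N (λ y → term x y)))
                        (sumL-factor (allFin N) (fitsσ σ) (λ x → δ (class x) i * extends σ x)
                                                          (λ y → δ (class y) j * extends σ y))
      where
      reorder : ∀ a b w f g → a * (b * w) * (f * g) ≡ w * (a * g * (b * f))
      reorder = solve-∀
      term : ∀ x y → W (join σ x y) * (face i (join σ x y) * face j (join σ x y))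
                     ≡ fitsσ σ * (δ (class x) i * extends σ x * (δ (class y) j * extends σ y))
      term x y = trans (cong (_* (face i (join σ x y) * face j (join σ x y))) (W-join σ x y))
                       (trans (reorder (δ (class x) i) (δ (class y) j) (fitsσ σ) (face i (join σ x y)) (face j (join σ x y)))
                              (cong₂ (λ a b → fitsσ σ * (a * b)) (masked-face-j σ x y) (masked-face-i σ x y)))

    -- When σ fits, base σ is a partite (r-1)-set missing V_i and V_j, so the
    -- balance hypothesis gives Dᵢ σ = Dⱼ σ.
    module _ (σ : Vec (Fin N) (suc q)) (σ-fits : fitsσ σ ≡ 1) where
      anchor-transversal : ∀ c → class (lookup (anchor σ) c) ≡ c
      anchor-transversal = W-transversal (anchor σ) (subst (0 <_) (sym W≡1) (s≤s z≤n))
        where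
        W≡1 : W (anchor σ) ≡ 1
        W≡1 = begin
            W (anchor σ)
          ≡⟨ W-join σ (rep dens i) (rep dens j) ⟩
            δ (class (rep dens i)) i * (δ (class (rep dens j)) j * fitsσ σ)
          ≡⟨ cong₂ (λ a b → δ a i * (δ b j * fitsσ σ)) (rep-class dens i) (rep-class dens j) ⟩
            δ i i * (δ j j * fitsσ σ)
          ≡⟨ cong₂ (λ a b → a * (b * fitsσ σ)) (δ-refl i) (δ-refl j) ⟩
            1 * (1 * fitsσ σ)
          ≡⟨ trans (*-identityˡ _) (trans (*-identityˡ _) σ-fits) ⟩
            1
          ∎
          where open ≡-Reasoning

      card-base : ∣ base σ ∣ ≡ suc q
      card-base = trans (card-span others (anchor σ) anchor-transversal) (count-≢ᵇ₂ (suc q) i j′)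

      in-base : ∀ {u} → u ∈ base σ → others (class u) ≡ true × lookup (anchor σ) (class u) ≡ u
      in-base {u} u∈ =
        let (kept , picked) = ∧-split (trans (sym (lookup-span others (anchor σ) u)) ([]=⇒lookup u∈))
        in kept , ≡ᵇ-sound picked

      base-partite : IsPartite G (base σ)
      base-partite u v u∈ v∈ cu≡cv =
        trans (sym (proj₂ (in-base u∈))) (trans (cong (lookup (anchor σ)) cu≡cv) (proj₂ (in-base v∈)))

      base-avoids-i : Avoids G i (base σ)
      base-avoids-i v v∈ cv≡i with ∧-split (proj₁ (in-base v∈))
      ... | (v≢i , _) with trans (sym (not-true v≢i)) (trans (cong (_≡ᵇ i) cv≡i) (≡ᵇ-refl i))
      ...   | ()

      base-avoids-j : Avoids G j (base σ)
      base-avoids-j v v∈ cv≡j with ∧-split (proj₁ (in-base v∈))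
      ... | (_ , v≢j) with trans (sym (not-true v≢j)) (trans (cong (_≡ᵇ j) cv≡j) (≡ᵇ-refl j))
      ...   | ()

      degrees-equal : Dᵢ σ ≡ Dⱼ σ
      degrees-equal = trans (sym (deg-as-sum i (base σ)))
        (trans (bal (base σ) base-partite card-base i j i≢j base-avoids-i base-avoids-j) (deg-as-sum j (base σ)))

    balanced : ∀ σ (f : ℕ → ℕ) → fitsσ σ * f (Dⱼ σ) ≡ fitsσ σ * f (Dᵢ σ)
    balanced σ f with fits-bit (suc q) (λ c → punchIn i (punchIn j′ c)) σ
    ... | inj₁ fitsσ≡0     rewrite fitsσ≡0 = refl
    ... | inj₂ (fitsσ≡1 , _) = cong (λ z → fitsσ σ * f z) (sym (degrees-equal σ fitsσ≡1))

    -- the common value Y = Σ_σ D(σ) expresses both E_i and E_j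
    Y : ℕ
    Y = Σv (suc q) (λ σ → fitsσ σ * Dᵢ σ)

    E-i≡ : E i ≡ size i * Y
    E-i≡ = trans (Σv-join (λ t → W t * face i t))
           (trans (Σv-cong (suc q) (λ σ → trans (Σxy-face-i σ)
                    (trans (balanced σ (λ z → size i * z)) (reorder (fitsσ σ) (size i) (Dᵢ σ)))))
                  (sumL-*ˡ (allVecs (suc q)) (size i) (λ σ → fitsσ σ * Dᵢ σ)))
      where
      reorder : ∀ w n d → w * (n * d) ≡ n * (w * d)
      reorder = solve-∀

    E-j≡ : E j ≡ size j * Y
    E-j≡ = trans (Σv-join (λ t → W t * face j t))
           (trans (Σv-cong (suc q) (λ σ → trans (Σxy-face-j σ) (reorder (fitsσ σ) (size j) (Dᵢ σ))))
                  (sumL-*ˡ (allVecs (suc q)) (size j) (λ σ → fitsσ σ * Dᵢ σ)))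
      where
      reorder : ∀ w n d → w * (d * n) ≡ n * (w * d)
      reorder = solve-∀

    Π≡ : Π ≡ (size i * size j) * Σv (suc q) fitsσ
    Π≡ = trans (Σv-join W) (trans (Σv-cong (suc q) Σxy-W)
          (trans (sumL-*ʳ (allVecs (suc q)) (size i * size j) fitsσ) (*-comm _ (size i * size j))))

    P≡ : P i j ≡ Σv (suc q) (λ σ → fitsσ σ * (Dᵢ σ * Dᵢ σ))
    P≡ = trans (Σv-join (λ t → W t * (face i t * face j t)))
               (Σv-cong (suc q) (λ σ → trans (Σxy-faces σ) (balanced σ (λ z → Dᵢ σ * z))))

    pair : E i * E j ≤ Π * P i j
    pair = begin
        E i * E j
      ≡⟨ cong₂ _*_ E-i≡ E-j≡ ⟩
        size i * Y * (size j * Y)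
      ≡⟨ reorder (size i) (size j) Y ⟩
        (size i * size j) * (Y * Y)
      ≤⟨ *-monoʳ-≤ (size i * size j) (cauchy-schwarz (allVecs (suc q)) fitsσ Dᵢ) ⟩
        (size i * size j) * (Σv (suc q) fitsσ * Σv (suc q) (λ σ → fitsσ σ * (Dᵢ σ * Dᵢ σ)))
      ≡⟨ sym (*-assoc (size i * size j) _ _) ⟩
        (size i * size j) * Σv (suc q) fitsσ * Σv (suc q) (λ σ → fitsσ σ * (Dᵢ σ * Dᵢ σ))
      ≡⟨ sym (cong₂ _*_ Π≡ P≡) ⟩
        Π * P i j
      ∎
      where
      open ≤-Reasoning
      reorder : ∀ a b y → a * y * (b * y) ≡ (a * b) * (y * y)
      reorder = solve-∀

  pair-inequality : AllStrictlyBalanced G → (∀ i → DensityAbove G i) →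
                    ∀ i j → ¬ i ≡ j → E i * E j ≤ Π * P i j
  pair-inequality bal dens i j i≢j =
    subst (λ z → E i * E z ≤ Π * P i z) (punchIn-punchOut i≢j) (ForPair.pair bal dens i (punchOut i≢j))

-- Steps (3), (4) and the extraction of the clique.
module Conclusion (q : ℕ) (G : PartiteGraph (suc (suc q))) where
  open PartiteGraph G
  open Transversals q G
  open Density q G using (density-faces)
  open PairInequality q G

  transversal-clique : ∀ t → (∀ c → class (lookup t c) ≡ c) → (∀ k → face k t ≡ 1) → ContainsK G
  transversal-clique t tr faces = S , |S| , every-r-subset
    where
    S : Subset N
    S = span (λ _ → true) t
    |S| : ∣ S ∣ ≡ suc r
    |S| = trans (card-span (λ _ → true) t tr) (ΣF-1 M)
    picked : ∀ {u} → u ∈ S → lookup t (class u) ≡ u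
    picked {u} u∈S = ≡ᵇ-sound (trans (sym (lookup-span (λ _ → true) t u)) ([]=⇒lookup u∈S))
    every-r-subset : ∀ T → T ⊆ S → ∣ T ∣ ≡ r → edge T ≡ true
    every-r-subset T T⊆S |T| = trans (cong edge T≡face) (𝟙-pos (subst (0 <_) (sym (faces k)) (s≤s z≤n)))
      where
      -- T misses some vertex v of S; T is then the face opposite the class of v
      missing : Σ (Fin N) (λ v → lookup S v ≡ true × lookup T v ≡ false)
      missing = missing-element S T (subst (_< ∣ S ∣) (sym |T|) (subst (r <_) (sym |S|) ≤-refl))
      v : Fin N
      v = proj₁ missing
      k : Fin M
      k = class v
      face-set : Subset N
      face-set = span (_≢ᵇ k) t
      T⊆face : T ⊆ face-set
      T⊆face {u} u∈T = lookup⇒[]= u face-set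
        (trans (lookup-span (_≢ᵇ k) t u)
               (cong₂ (λ a b → not a ∧ b) (≡ᵇ-≢ cu≢k) (trans (cong (_≡ᵇ u) t-u) (≡ᵇ-refl u))))
        where
        t-u : lookup t (class u) ≡ u
        t-u = picked (T⊆S u∈T)
        cu≢k : ¬ class u ≡ k
        cu≢k cu≡k = true≢false (trans (sym ([]=⇒lookup (subst (_∈ T) u≡v u∈T))) (proj₂ (proj₂ missing)))
          where
          u≡v : u ≡ v
          u≡v = trans (sym t-u) (trans (cong (lookup t) cu≡k) (picked (lookup⇒[]= v S (proj₁ (proj₂ missing)))))
      T≡face : T ≡ face-set
      T≡face = ⊆-same-size T⊆face (trans |T| (sym (trans (card-span (_≢ᵇ k) t tr) (count-≢ᵇ r k))))

  CliqueTransversal : Set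
  CliqueTransversal = Σ (Vec (Fin N) M) (λ t → (∀ c → class (lookup t c) ≡ c) × (∀ k → face k t ≡ 1))

  Defective : Set
  Defective = ∀ t → 0 < W t → Σ (Fin M) (λ k → face k t ≡ 0)

  -- one of the two holds, decided by counting transversals with all faces edges
  clique-or-defective : CliqueTransversal ⊎ Defective
  clique-or-defective = by-count (Σv M count) refl
    where
    count : Vec (Fin N) M → ℕ
    count t = W t * ΠF M (λ k → face k t)
    faces-bits : ∀ t → (ΠF M (λ k → face k t) ≡ 0 × Σ (Fin M) (λ k → face k t ≡ 0))
                     ⊎ (ΠF M (λ k → face k t) ≡ 1 × (∀ k → face k t ≡ 1))
    faces-bits t = ΠF-bits M (λ k → face k t) (λ k → 𝟙≤1 (edge (span (_≢ᵇ k) t)))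
    by-count : ∀ n → Σv M count ≡ n → CliqueTransversal ⊎ Defective
    by-count zero    none = inj₂ defective
      where
      defective : Defective
      defective t W>0 with faces-bits t
      ... | inj₁ (_ , k , face≡0) = k , face≡0
      ... | inj₂ (all≡1 , _) = ⊥-elim (n≮0 (≤-trans count>0 (subst (count t ≤_) none (sumL-term count (∈-allVecs M t)))))
        where
        count>0 : 0 < count t
        count>0 = subst (0 <_) (sym (trans (cong (W t *_) all≡1) (*-identityʳ (W t)))) W>0
    by-count (suc _) some with sumL-pos (allVecs M) count (subst (0 <_) (sym some) (s≤s z≤n))
    ... | t , count>0 with pos-* (W t) _ count>0 | faces-bits t
    ...   | (W>0 , _) | inj₂ (_ , all≡1) = inj₁ (t , W-transversal t W>0 , all≡1)
    ...   | (_ , Π>0) | inj₁ (Π≡0 , _)   = ⊥-elim (<-irrefl (sym Π≡0) Π>0)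

  X : ℕ
  X = ΣF M E

  Σ≠-P : Σ≠ M P ≡ Σv M (λ t → W t * Σ≠ M (λ i j → face i t * face j t))
  Σ≠-P = begin
      Σ≠ M P
    ≡⟨ ΣF-cong M (λ i → ΣF-cong M (λ j → sym (sumL-*ˡ (allVecs M) (ν i j) (term i j)))) ⟩
      ΣF M (λ i → ΣF M (λ j → Σv M (λ t → ν i j * term i j t)))
    ≡⟨ ΣF-cong M (λ i → sumL-swap (allFin M) (allVecs M) (λ j t → ν i j * term i j t)) ⟩
      ΣF M (λ i → Σv M (λ t → ΣF M (λ j → ν i j * term i j t)))
    ≡⟨ sumL-swap (allFin M) (allVecs M) (λ i t → ΣF M (λ j → ν i j * term i j t)) ⟩
      Σv M (λ t → ΣF M (λ i → ΣF M (λ j → ν i j * term i j t)))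
    ≡⟨ Σv-cong M (λ t → Σ≠-*ˡ M (W t) (λ i j → face i t * face j t)) ⟩
      Σv M (λ t → W t * Σ≠ M (λ i j → face i t * face j t))
    ∎
    where
    open ≡-Reasoning
    ν : Fin M → Fin M → ℕ
    ν i j = 𝟙 (i ≢ᵇ j)
    term : Fin M → Fin M → Vec (Fin N) M → ℕ
    term i j t = W t * (face i t * face j t)

  Σv-faces : Σv M (λ t → W t * ΣF M (λ k → face k t)) ≡ X
  Σv-faces = trans (Σv-cong M (λ t → sym (sumL-*ˡ (allFin M) (W t) (λ k → face k t))))
                   (sumL-swap (allVecs M) (allFin M) (λ t k → W t * face k t))

  defective-bound : Defective → Σ≠ M P ≤ suc q * X
  defective-bound defective = begin
      Σ≠ M P
    ≡⟨ Σ≠-P ⟩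
      Σv M (λ t → W t * Σ≠ M (λ i j → face i t * face j t))
    ≤⟨ sumL-mono (allVecs M) pointwise ⟩
      Σv M (λ t → suc q * (W t * ΣF M (λ k → face k t)))
    ≡⟨ sumL-*ˡ (allVecs M) (suc q) (λ t → W t * ΣF M (λ k → face k t)) ⟩
      suc q * Σv M (λ t → W t * ΣF M (λ k → face k t))
    ≡⟨ cong (suc q *_) Σv-faces ⟩
      suc q * X
    ∎
    where
    open ≤-Reasoning
    edgeAt : Vec (Fin N) M → Fin M → Bool
    edgeAt t k = edge (span (_≢ᵇ k) t)
    pointwise : ∀ t → W t * Σ≠ M (λ i j → face i t * face j t) ≤ suc q * (W t * ΣF M (λ k → face k t))
    pointwise t with fits-bit M (λ c → c) t
    ... | inj₁ W≡0 rewrite W≡0 = z≤n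
    ... | inj₂ (W≡1 , _) rewrite W≡1 =
      let (k , face≡0) = defective t (subst (0 <_) (sym W≡1) (s≤s z≤n))
      in subst₂ _≤_ (sym (+-identityʳ _)) (cong (suc q *_) (sym (+-identityʳ _)))
                (Σ≠-bits (suc q) (edgeAt t) k (𝟙-zero face≡0))

  defective-absurd : AllStrictlyBalanced G → (∀ i → DensityAbove G i) → ¬ Defective
  defective-absurd bal dens defective = <⇒≱ lower upper
    where
    p : ℕ
    p = suc q * Π
    p<rE : ∀ k → p < r * E k
    p<rE = density-faces dens
    EE : ℕ
    EE = Σ≠ M (λ i j → E i * E j)
    lower : p * (r * X + r * X) < 2 * r * EE
    lower = begin-strict
        p * (r * X + r * X)
      ≡⟨ cong (p *_) (sym (Σ≠-+ r E)) ⟩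
        p * Σ≠ M (λ i j → E i + E j)
      ≡⟨ sym (Σ≠-*ˡ M p (λ i j → E i + E j)) ⟩
        Σ≠ M (λ i j → p * (E i + E j))
      <⟨ Σ≠-strict M (λ i j _ → <⇒≤ (pair-arith p r (E i) (E j) (p<rE i) (p<rE j)))
                     zero (suc zero) (λ ()) (pair-arith p r (E zero) (E (suc zero)) (p<rE zero) (p<rE (suc zero))) ⟩
        Σ≠ M (λ i j → 2 * r * (E i * E j))
      ≡⟨ Σ≠-*ˡ M (2 * r) (λ i j → E i * E j) ⟩
        2 * r * EE
      ∎
      where open ≤-Reasoning
    upper : 2 * r * EE ≤ p * (r * X + r * X)
    upper = begin
        2 * r * EE
      ≤⟨ *-monoʳ-≤ (2 * r) (Σ≠-mono M (pair-inequality bal dens)) ⟩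
        2 * r * Σ≠ M (λ i j → Π * P i j)
      ≡⟨ cong (2 * r *_) (Σ≠-*ˡ M Π P) ⟩
        2 * r * (Π * Σ≠ M P)
      ≤⟨ *-monoʳ-≤ (2 * r) (*-monoʳ-≤ Π (defective-bound defective)) ⟩
        2 * r * (Π * (suc q * X))
      ≡⟨ reorder r Π (suc q) X ⟩
        suc q * Π * (r * X + r * X)
      ∎
      where
      open ≤-Reasoning
      reorder : ∀ r Π s X → 2 * r * (Π * (s * X)) ≡ s * Π * (r * X + r * X)
      reorder = solve-∀

corollary3p5 : (r : ℕ) → 2 ≤ r → (G : PartiteGraph r) →
    AllStrictlyBalanced G →
    (∀ i → DensityAbove G i) →
    ContainsK G
corollary3p5 (suc (suc q)) (s≤s (s≤s z≤n)) G bal dens with Conclusion.clique-or-defective q G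
... | inj₁ (t , transversal , faces) = Conclusion.transversal-clique q G t transversal faces
... | inj₂ defective                 = ⊥-elim (Conclusion.defective-absurd q G bal dens defective)
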